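{- Let $k\ge1$ and for $1\le i,j\le k$ let $\mathcal{B}^k_{i,j}(x)=\sum_{n\ge1} B^k_{i,j}(n)\frac{x^n}{n!}$ (formal power series with zero constant term), with $\mathcal{B}^k_{i,j}=0$ whenever $i<1$ or $j<1$. Then for all $i,j=1,2,\dots,k$, $$\frac{d}{dx}\mathcal{B}_{i,j}^k(x) = 1 + \mathcal{B}_{i-1,j}^k(x) + \mathcal{B}_{i,j-1}^k(x) + \mathcal{B}_{i,k-1}^k(x)\,\mathcal{B}_{k-1,j}^k(x).$$
   Context: For a permutation $p=(p_1,\dots,p_n)$ of $\{1,\dots,n\}$, a (monotonic) run is a maximal increasing or maximal decreasing subsequence of consecutive entries $p_a,\dots,p_b$; its length is $b-a+1$. For $n\ge2$, the run containing $p_1,p_2$ is the initial decreasing run if $p_1>p_2$, and the run containing $p_{n-1},p_n$ is the final increasing run if $p_{n-1}<p_n$. For integers $k\ge1$, $1\le i,j\le k$, $n\ge1$, $B^k_{i,j}(n)$ is the number of permutations of $\{1,\dots,n\}$ all of whose runs have length at most $k$, whose initial decreasing run (if present) has length at most $i$, and whose final increasing run (if present) has length at most $j$; by convention $B^k_{i,j}(1)=1$ for $1\le i,j\le k$, and $B^k_{i,j}(n)=0$ whenever $i<1$ or $j<1$. -}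

module Defs where

open import Data.Bool using (Bool; true; false; if_then_else_; _∧_)
open import Data.Nat as ℕ using (ℕ; zero; suc; _∸_; _<ᵇ_; _≤ᵇ_)
open import Data.Nat.Properties using (_!≢0)
open import Data.Nat using (_!)
open import Data.List using (List; []; _∷_; length; map; concatMap; filter; filterᵇ; applyUpTo; reverse)
import Data.List.Relation.Unary.Unique.DecPropositional as UniqueDec
open import Data.Integer using (+_)
open import Relation.Binary.PropositionalEquality using (_≡_)
open import Data.Rational using (ℚ; 0ℚ; 1ℚ; _+_; _*_; _/_)

words : ℕ → ℕ → List (List ℕ)
words m zero    = [] ∷ []
words m (suc n) = concatMap (λ w → applyUpTo (λ a → suc a ∷ w) m) (words m n)

perms : ℕ → List (List ℕ)
perms n = filter (UniqueDec.unique? ℕ._≟_) (words n n)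

monoPrefix : (ℕ → ℕ → Bool) → List ℕ → ℕ
monoPrefix r []           = 0
monoPrefix r (x ∷ [])     = 1
monoPrefix r (x ∷ y ∷ xs) = if r x y then suc (monoPrefix r (y ∷ xs)) else 1

incPrefix decPrefix : List ℕ → ℕ
incPrefix = monoPrefix (λ x y → x <ᵇ y)
decPrefix = monoPrefix (λ x y → y <ᵇ x)

-- Every run starts at some position a and equals the maximal monotone
-- segment starting at a, i.e. the monotone prefix of the suffix p_a … p_n.
allRunsAtMost : ℕ → List ℕ → Bool
allRunsAtMost k []       = true
allRunsAtMost k (x ∷ xs) =
  (incPrefix (x ∷ xs) ≤ᵇ k) ∧ (decPrefix (x ∷ xs) ≤ᵇ k) ∧ allRunsAtMost k xs

-- length of the initial decreasing run (1 if p₁ < p₂, i.e. no such run;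
-- the constraint "≤ i" is then vacuous as i ≥ 1)
initDecRun : List ℕ → ℕ
initDecRun = decPrefix

finalIncRun : List ℕ → ℕ
finalIncRun p = decPrefix (reverse p)

admissible : ℕ → ℕ → ℕ → List ℕ → Bool
admissible k i j p =
  allRunsAtMost k p ∧ (initDecRun p ≤ᵇ i) ∧ (finalIncRun p ≤ᵇ j)

B : ℕ → ℕ → ℕ → ℕ → ℕ
B k zero    j       n = 0
B k (suc i) zero    n = 0
B k (suc i) (suc j) n = length (filterᵇ (admissible k (suc i) (suc j)) (perms n))

PowerSeries : Set
PowerSeries = ℕ → ℚ

_≈ₚ_ : PowerSeries → PowerSeries → Set
f ≈ₚ g = ∀ n → f n ≡ g n

oneₚ : PowerSeries
oneₚ zero    = 1ℚ
oneₚ (suc n) = 0ℚ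

_+ₚ_ : PowerSeries → PowerSeries → PowerSeries
(f +ₚ g) n = f n + g n

convSum : PowerSeries → PowerSeries → ℕ → ℕ → ℚ
convSum f g n zero    = f 0 * g n
convSum f g n (suc m) = convSum f g n m + f (suc m) * g (n ∸ suc m)

_*ₚ_ : PowerSeries → PowerSeries → PowerSeries
(f *ₚ g) n = convSum f g n n

deriv : PowerSeries → PowerSeries
deriv f n = ((+ suc n) / 1) * f (suc n)

egf : (ℕ → ℕ) → PowerSeries
egf a zero    = 0ℚ
egf a (suc n) = (+ a (suc n) / (suc n) !) {{suc n !≢0}}

𝓑 : ℕ → ℕ → ℕ → PowerSeries
𝓑 k i j = egf (B k i j)

-- Idea: split a permutation w of {1,…,n+1} at its largest entry, w = σ M τ.  No run
-- passes through M, so (runs, admissibility) w is admissible for (k,i,j) iff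
--   σ = τ = [];  or σ = [] and τ is (k,i-1,j)-admissible;  or τ = [] and σ is
--   (k,i,j-1)-admissible;  or σ is (k,i,k-1)- and τ is (k,k-1,j)-admissible.
-- To count, the permutations are generated as the arrangements of n+1, n, …, 1
-- (arrangements, permutations): a Boolean mask chooses the entries of σ, the others
-- go to τ, and both sides are arranged recursively.  These are exactly the
-- permutations, each once; the number of admissible arrangements of a set only
-- depends on its size, and grouping masks by size (finite sums) gives
--   B(n+1) = [n = 0] + B_{i-1,j}(n) + B_{i,j-1}(n) + Σ_m C(n,m) B_{i,k-1}(m) B_{k-1,j}(n-m)
-- with B(0) read as 0 on the right (the counting recurrence).
module Submission where

open import Defs
open import Data.Bool using (Bool; true; false; _∧_; not; T; if_then_else_)
open import Data.Bool.Properties using (∧-commutativeMonoid; ∧-identityʳ; ∧-zeroʳ; ∧-comm)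
open import Data.Empty using (⊥; ⊥-elim)
open import Algebra.Solver.CommutativeMonoid ∧-commutativeMonoid using (_⊜_; _⊕_) renaming (solve to ∧-solve)
import Data.Integer as ℤ
open import Data.Integer.Properties using (pos-*; pos-+)
open import Data.List using (List; []; _∷_; _++_; [_]; length; reverse; map; concatMap; filter; filterᵇ; applyUpTo; applyDownFrom)
open import Data.List.Properties
  using (reverse-++; unfold-reverse; length-reverse; ++-assoc; length-map; map-cong-local; map-++; map-∘;
         concatMap-cong; filter-notAll; ∷-injectiveˡ; ∷-injectiveʳ; ++-cancelˡ; length-applyDownFrom)
open import Data.List.Membership.Propositional using (_∈_; _∉_; find; lose)
open import Data.List.Membership.Propositional.Properties
  using (∈-++⁻; ∈-++⁺ˡ; ∈-++⁺ʳ; ∈-map⁺; ∈-map⁻; ∈-∃++; ∈-concatMap⁺; ∈-concatMap⁻; ∈-filter⁺; ∈-filter⁻;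
         ∈-applyUpTo⁺; ∈-applyUpTo⁻; ∈-applyDownFrom⁺; ∈-applyDownFrom⁻)
open import Data.List.Membership.Propositional.Properties.WithK using (unique∧set⇒bag)
open import Data.List.Relation.Binary.BagAndSetEquality using (∼bag⇒↭)
open import Data.List.Relation.Binary.Permutation.Propositional.Properties using (filter-↭; ↭-length)
open import Data.List.Relation.Unary.All as All using (All; []; _∷_)
import Data.List.Relation.Unary.All.Properties as Allₚ
open import Data.List.Relation.Unary.AllPairs as AllPairs using (AllPairs; []; _∷_)
open import Data.List.Relation.Unary.AllPairs.Properties using (applyDownFrom⁺₁)
open import Data.List.Relation.Unary.Any using (here; there)
import Data.List.Relation.Unary.Any as Any
open import Data.List.Relation.Unary.Unique.Propositional using (Unique)
open import Data.List.Relation.Unary.Unique.Propositional.Properties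
  using (Unique[x∷xs]⇒x∉xs; ++⁺; map⁺; applyUpTo⁺₁; filter⁺)
import Data.List.Relation.Unary.Unique.DecPropositional as UniqueDec
open import Data.Nat using (ℕ; zero; suc; _+_; _*_; _∸_; _<ᵇ_; _≤ᵇ_; _≤_; _<_; _>_; z≤n; s≤s; NonZero; _!)
open import Data.Nat.Combinatorics using (_C_; nCn≡1; k>n⇒nCk≡0; nCk+nC[k+1]≡[n+1]C[k+1]; nCk≡n!/k![n-k]!; k![n∸k]!∣n!)
open import Data.Nat.DivMod using (m/n*n≡m)
open import Data.Nat.ListAction using (sum)
open import Data.Nat.ListAction.Properties using (sum-++)
open import Data.Nat.Properties
  using (_≟_; <ᵇ⇒<; <⇒<ᵇ; ≤⇒≤ᵇ; ≤ᵇ⇒≤; <-asym; <-irrefl; >⇒≢; ≤-refl; ≤-reflexive; ≤-trans; ≤-antisym; ≤-<-trans;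
         n≤1+n; suc-injective; +-assoc; +-comm; +-identityʳ; *-identityˡ; *-zeroʳ; *-distribˡ-+; *-distribʳ-+;
         n∸n≡0; m∸n≤m; +-∸-assoc; <⇒≤; m*n≢0; _!≢0)
open import Data.List.Membership.DecPropositional _≟_ using (_∈?_)
open import Data.Nat.Solver using (module +-*-Solver)
open +-*-Solver using (solve; _:+_; _:*_; _:=_)
open import Data.Product using (_×_; _,_; proj₁; proj₂)
open import Data.Rational using (ℚ; _/_; toℚᵘ)
import Data.Rational as ℚ
import Data.Rational.Properties as ℚₚ
open import Data.Rational.Unnormalised using (mkℚᵘ; *≡*) renaming (_≃_ to _≃ᵘ_)
import Data.Rational.Unnormalised.Properties as ℚᵘₚ
open import Data.Sum using (_⊎_; inj₁; inj₂)
open import Function.Bundles using (mk⇔)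
open import Relation.Binary.PropositionalEquality
  using (_≡_; _≢_; refl; sym; trans; cong; cong₂; subst; module ≡-Reasoning)
open import Relation.Nullary using (¬_; Dec; yes; no; does)
open import Relation.Nullary.Decidable using (¬?; dec-true; dec-false)

T⇒≡ : ∀ {b} → T b → b ≡ true
T⇒≡ {true} _ = refl

<ᵇ-true : ∀ {x y} → x < y → (x <ᵇ y) ≡ true
<ᵇ-true x<y = T⇒≡ (<⇒<ᵇ x<y)

<ᵇ-false : ∀ {x y} → y < x → (x <ᵇ y) ≡ false
<ᵇ-false {x} {y} y<x with x <ᵇ y in eq
... | false = refl
... | true  = ⊥-elim (<-asym y<x (<ᵇ⇒< x y (subst T (sym eq) _)))

≤ᵇ-true : ∀ {x y} → x ≤ y → (x ≤ᵇ y) ≡ true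
≤ᵇ-true x≤y = T⇒≡ (≤⇒≤ᵇ x≤y)

suc≤ᵇ : ∀ a k → 1 ≤ k → (suc a ≤ᵇ k) ≡ (a ≤ᵇ (k ∸ 1))
suc≤ᵇ zero    (suc k) _ = refl
suc≤ᵇ (suc a) (suc k) _ = refl

∧-trueˡ : ∀ {a b} → a ∧ b ≡ true → a ≡ true
∧-trueˡ {true} _ = refl

∧-trueʳ : ∀ {a b} → a ∧ b ≡ true → b ≡ true
∧-trueʳ {true} c = c

∧-absorbˡ : ∀ a b → (b ≡ true → a ≡ true) → a ∧ b ≡ b
∧-absorbˡ true  b       _ = refl
∧-absorbˡ false false   _ = refl
∧-absorbˡ false true  b⇒a = b⇒a refl


_<ᵣ_ _>ᵣ_ : ℕ → ℕ → Bool
x <ᵣ y = x <ᵇ y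
x >ᵣ y = y <ᵇ x

chain : (ℕ → ℕ → Bool) → List ℕ → Bool
chain r []          = true
chain r (x ∷ [])    = true
chain r (x ∷ y ∷ u) = r x y ∧ chain r (y ∷ u)

if-congᵗ : ∀ {A : Set} b {x x′ y : A} → (b ≡ true → x ≡ x′) →
           (if b then x else y) ≡ (if b then x′ else y)
if-congᵗ true  eq = eq refl
if-congᵗ false eq = refl

module _ (r : ℕ → ℕ → Bool) where

  monoPrefix-step : ∀ x y w → r x y ≡ true → monoPrefix r (x ∷ y ∷ w) ≡ suc (monoPrefix r (y ∷ w))
  monoPrefix-step x y w rxy = cong (λ b → if b then suc (monoPrefix r (y ∷ w)) else 1) rxy

  monoPrefix-stop : ∀ x y w → r x y ≡ false → monoPrefix r (x ∷ y ∷ w) ≡ 1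
  monoPrefix-stop x y w rxy = cong (λ b → if b then suc (monoPrefix r (y ∷ w)) else 1) rxy

  monoPrefix-cong : ∀ x y u v → monoPrefix r (y ∷ u) ≡ monoPrefix r (y ∷ v) →
                    monoPrefix r (x ∷ y ∷ u) ≡ monoPrefix r (x ∷ y ∷ v)
  monoPrefix-cong x y u v eq = if-congᵗ (r x y) (λ _ → cong suc eq)

  monoPrefix-chain : ∀ u → chain r u ≡ true → monoPrefix r u ≡ length u
  monoPrefix-chain []          _ = refl
  monoPrefix-chain (x ∷ [])    _ = refl
  monoPrefix-chain (x ∷ y ∷ u) c =
    trans (monoPrefix-step x y u (∧-trueˡ c)) (cong suc (monoPrefix-chain (y ∷ u) (∧-trueʳ c)))

  monoPrefix-++ : ∀ u v → chain r u ≡ false → monoPrefix r (u ++ v) ≡ monoPrefix r u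
  monoPrefix-++ (x ∷ y ∷ u) v c = if-congᵗ (r x y)
    (λ rxy → cong suc (monoPrefix-++ (y ∷ u) v (trans (cong (_∧ chain r (y ∷ u)) (sym rxy)) c)))

  chain-snoc : ∀ u y x → chain r (u ++ y ∷ x ∷ []) ≡ chain r (u ++ [ y ]) ∧ r y x
  chain-snoc []          y x = ∧-identityʳ (r y x)
  chain-snoc (a ∷ [])    y x =
    trans (cong (r a y ∧_) (∧-identityʳ (r y x))) (cong (_∧ r y x) (sym (∧-identityʳ (r a y))))
  chain-snoc (a ∷ b ∷ u) y x = trans (cong (r a b ∧_) (chain-snoc (b ∷ u) y x))
    (∧-solve 3 (λ p q s → p ⊕ (q ⊕ s) ⊜ (p ⊕ q) ⊕ s) refl (r a b) (chain r (b ∷ u ++ [ y ])) (r y x))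

  monoPrefix-chain-stop : ∀ u y x → chain r (u ++ [ y ]) ≡ true → r y x ≡ false →
                          monoPrefix r (u ++ y ∷ x ∷ []) ≡ suc (length u)
  monoPrefix-chain-stop []          y x _ ryx = monoPrefix-stop y x [] ryx
  monoPrefix-chain-stop (a ∷ [])    y x c ryx =
    trans (monoPrefix-step a y (x ∷ []) (∧-trueˡ c)) (cong suc (monoPrefix-stop y x [] ryx))
  monoPrefix-chain-stop (a ∷ b ∷ u) y x c ryx =
    trans (monoPrefix-step a b (u ++ y ∷ x ∷ []) (∧-trueˡ c))
          (cong suc (monoPrefix-chain-stop (b ∷ u) y x (∧-trueʳ c) ryx))

reverse-∷∷ : ∀ (x y : ℕ) u → reverse (x ∷ y ∷ u) ≡ reverse u ++ y ∷ x ∷ []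
reverse-∷∷ x y u = trans (unfold-reverse x (y ∷ u))
  (trans (cong (_++ [ x ]) (unfold-reverse y u)) (++-assoc (reverse u) [ y ] [ x ]))

chain-reverse : ∀ u → chain _>ᵣ_ (reverse u) ≡ chain _<ᵣ_ u
chain-reverse []          = refl
chain-reverse (x ∷ [])    = refl
chain-reverse (x ∷ y ∷ u) = begin
  chain _>ᵣ_ (reverse (x ∷ y ∷ u))             ≡⟨ cong (chain _>ᵣ_) (reverse-∷∷ x y u) ⟩
  chain _>ᵣ_ (reverse u ++ y ∷ x ∷ [])         ≡⟨ chain-snoc _>ᵣ_ (reverse u) y x ⟩
  chain _>ᵣ_ (reverse u ++ [ y ]) ∧ (x <ᵇ y)   ≡⟨ cong (λ c → chain _>ᵣ_ c ∧ (x <ᵇ y)) (sym (unfold-reverse y u)) ⟩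
  chain _>ᵣ_ (reverse (y ∷ u)) ∧ (x <ᵇ y)      ≡⟨ cong (_∧ (x <ᵇ y)) (chain-reverse (y ∷ u)) ⟩
  chain _<ᵣ_ (y ∷ u) ∧ (x <ᵇ y)                ≡⟨ ∧-comm (chain _<ᵣ_ (y ∷ u)) (x <ᵇ y) ⟩
  chain _<ᵣ_ (x ∷ y ∷ u)                       ∎
  where open ≡-Reasoning

finalIncRun-chain : ∀ u → chain _<ᵣ_ u ≡ true → finalIncRun u ≡ length u
finalIncRun-chain u c =
  trans (monoPrefix-chain _>ᵣ_ (reverse u) (trans (chain-reverse u) c)) (length-reverse u)

finalIncRun-cons : ∀ x s → chain _<ᵣ_ (x ∷ s) ≡ false → finalIncRun (x ∷ s) ≡ finalIncRun s
finalIncRun-cons x s c with chain _<ᵣ_ s in cs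
... | false = trans (cong decPrefix (unfold-reverse x s))
                    (monoPrefix-++ _>ᵣ_ (reverse s) [ x ] (trans (chain-reverse s) cs))
finalIncRun-cons x (y ∷ u) c | true = begin
  decPrefix (reverse (x ∷ y ∷ u))       ≡⟨ cong decPrefix (reverse-∷∷ x y u) ⟩
  decPrefix (reverse u ++ y ∷ x ∷ [])   ≡⟨ monoPrefix-chain-stop _>ᵣ_ (reverse u) y x chain-ry (x≮y c) ⟩
  suc (length (reverse u))              ≡⟨ cong suc (length-reverse u) ⟩
  length (y ∷ u)                        ≡⟨ finalIncRun-chain (y ∷ u) cs ⟨
  finalIncRun (y ∷ u)                   ∎
  where
  open ≡-Reasoning
  chain-ry : chain _>ᵣ_ (reverse u ++ [ y ]) ≡ true
  chain-ry = trans (cong (chain _>ᵣ_) (sym (unfold-reverse y u))) (trans (chain-reverse (y ∷ u)) cs)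
  x≮y : (x <ᵇ y) ∧ chain _<ᵣ_ (y ∷ u) ≡ false → (x <ᵇ y) ≡ false
  x≮y c = trans (sym (∧-identityʳ (x <ᵇ y))) (trans (cong ((x <ᵇ y) ∧_) (sym cs)) c)


All-reverse : ∀ {P : ℕ → Set} u → All P u → All P (reverse u)
All-reverse []      []       = []
All-reverse (x ∷ u) (p ∷ ps) = subst (All _) (sym (unfold-reverse x u)) (Allₚ.++⁺ (All-reverse u ps) (p ∷ []))

reverse-≢[] : ∀ (u : List ℕ) → u ≢ [] → reverse u ≢ []
reverse-≢[] []      u≢[] _  = u≢[] refl
reverse-≢[] (x ∷ u) _    eq with () ← trans (sym (length-reverse (x ∷ u))) (cong length eq)

-- a decreasing run cannot climb up to M
decPrefix-before-max : ∀ σ M t → All (_< M) σ → σ ≢ [] → decPrefix (σ ++ M ∷ t) ≡ decPrefix σ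
decPrefix-before-max []          M t _                σ≢[] = ⊥-elim (σ≢[] refl)
decPrefix-before-max (x ∷ [])    M t (x<M ∷ [])       _    = monoPrefix-stop _>ᵣ_ x M t (<ᵇ-false x<M)
decPrefix-before-max (x ∷ y ∷ σ) M t (_ ∷ y∷σ<M) _    =
  monoPrefix-cong _>ᵣ_ x y (σ ++ M ∷ t) σ (decPrefix-before-max (y ∷ σ) M t y∷σ<M (λ ()))

-- an increasing run stops at M
incPrefix-across-max : ∀ σ M t → All (_< M) σ → All (_< M) t →
                       incPrefix (σ ++ M ∷ t) ≡ incPrefix (σ ++ [ M ])
incPrefix-across-max []          M []      _ _               = refl
incPrefix-across-max []          M (y ∷ t) _ (y<M ∷ _)       = monoPrefix-stop _<ᵣ_ M y t (<ᵇ-false y<M)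
incPrefix-across-max (x ∷ [])    M t       _ t<M             =
  monoPrefix-cong _<ᵣ_ x M t [] (incPrefix-across-max [] M t [] t<M)
incPrefix-across-max (x ∷ y ∷ σ) M t (_ ∷ y∷σ<M) t<M =
  monoPrefix-cong _<ᵣ_ x y (σ ++ M ∷ t) (σ ++ [ M ]) (incPrefix-across-max (y ∷ σ) M t y∷σ<M t<M)

incPrefix-chain-max : ∀ u M → All (_< M) u → chain _<ᵣ_ u ≡ true → incPrefix (u ++ [ M ]) ≡ suc (length u)
incPrefix-chain-max []          M _           _ = refl
incPrefix-chain-max (x ∷ [])    M (x<M ∷ _)   _ = monoPrefix-step _<ᵣ_ x M [] (<ᵇ-true x<M)
incPrefix-chain-max (x ∷ y ∷ u) M (_ ∷ y∷u<M) c =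
  trans (monoPrefix-step _<ᵣ_ x y (u ++ [ M ]) (∧-trueˡ c))
        (cong suc (incPrefix-chain-max (y ∷ u) M y∷u<M (∧-trueʳ c)))

decPrefix-from-max : ∀ M τ → All (_< M) τ → τ ≢ [] → decPrefix (M ∷ τ) ≡ suc (decPrefix τ)
decPrefix-from-max M []      _         τ≢[] = ⊥-elim (τ≢[] refl)
decPrefix-from-max M (y ∷ τ) (y<M ∷ _) _    = monoPrefix-step _>ᵣ_ M y τ (<ᵇ-true y<M)

incPrefix-from-max : ∀ M τ → All (_< M) τ → incPrefix (M ∷ τ) ≡ 1
incPrefix-from-max M []      _         = refl
incPrefix-from-max M (y ∷ τ) (y<M ∷ _) = monoPrefix-stop _<ᵣ_ M y τ (<ᵇ-false y<M)

-- reversing σ M τ gives rev τ M rev σ, which moves final runs to the front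
reverse-around : ∀ (σ : List ℕ) M τ → reverse (σ ++ M ∷ τ) ≡ reverse τ ++ M ∷ reverse σ
reverse-around σ M τ = trans (reverse-++ σ (M ∷ τ))
  (trans (cong (_++ reverse σ) (unfold-reverse M τ)) (++-assoc (reverse τ) [ M ] (reverse σ)))

finalIncRun-after-max : ∀ σ M τ → All (_< M) τ → τ ≢ [] → finalIncRun (σ ++ M ∷ τ) ≡ finalIncRun τ
finalIncRun-after-max σ M τ τ<M τ≢[] = trans (cong decPrefix (reverse-around σ M τ))
  (decPrefix-before-max (reverse τ) M (reverse σ) (All-reverse τ τ<M) (reverse-≢[] τ τ≢[]))

finalIncRun-at-max : ∀ σ M → All (_< M) σ → σ ≢ [] → finalIncRun (σ ++ [ M ]) ≡ suc (finalIncRun σ)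
finalIncRun-at-max σ M σ<M σ≢[] = trans (cong decPrefix (reverse-around σ M []))
  (decPrefix-from-max M (reverse σ) (All-reverse σ σ<M) (reverse-≢[] σ σ≢[]))


module RunLengths (k : ℕ) (1≤k : 1 ≤ k) where

  runsOK : List ℕ → Bool
  runsOK = allRunsAtMost k

  runsOK-single : ∀ M → runsOK [ M ] ≡ true
  runsOK-single M rewrite ≤ᵇ-true 1≤k = refl

  -- runs never pass through M, so the two sides of M can be checked separately
  runsOK-split : ∀ σ M τ → All (_< M) σ → All (_< M) τ →
                 runsOK (σ ++ M ∷ τ) ≡ runsOK (σ ++ [ M ]) ∧ runsOK (M ∷ τ)
  runsOK-split []      M τ _ _ rewrite runsOK-single M = refl
  runsOK-split (x ∷ σ) M τ x∷σ<M@(_ ∷ σ<M) τ<M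
    rewrite incPrefix-across-max (x ∷ σ) M τ x∷σ<M τ<M
          | decPrefix-before-max (x ∷ σ) M τ x∷σ<M (λ ())
          | decPrefix-before-max (x ∷ σ) M [] x∷σ<M (λ ())
          | runsOK-split σ M τ σ<M τ<M =
    ∧-solve 4 (λ a b c d → a ⊕ b ⊕ (c ⊕ d) ⊜ (a ⊕ b ⊕ c) ⊕ d) refl
      (incPrefix (x ∷ σ ++ [ M ]) ≤ᵇ k) (decPrefix (x ∷ σ) ≤ᵇ k) (runsOK (σ ++ [ M ])) (runsOK (M ∷ τ))

  -- appending M lengthens the final increasing run by one and creates no other long run
  runsOK-ending-at-max : ∀ σ M → All (_< M) σ → σ ≢ [] →
                         runsOK (σ ++ [ M ]) ≡ runsOK σ ∧ (suc (finalIncRun σ) ≤ᵇ k)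
  runsOK-ending-at-max []          M _ σ≢[] = ⊥-elim (σ≢[] refl)
  runsOK-ending-at-max (x ∷ [])    M (x<M ∷ _) _
    rewrite monoPrefix-step _<ᵣ_ x M [] (<ᵇ-true x<M) | monoPrefix-stop _>ᵣ_ x M [] (<ᵇ-false x<M)
          | ≤ᵇ-true 1≤k = ∧-identityʳ _
  runsOK-ending-at-max (x ∷ y ∷ u) M x∷y∷u<M@(_ ∷ y∷u<M) _
    rewrite decPrefix-before-max (x ∷ y ∷ u) M [] x∷y∷u<M (λ ())
          | runsOK-ending-at-max (y ∷ u) M y∷u<M (λ ()) = by-chain (chain _<ᵣ_ (x ∷ y ∷ u)) refl
    where
    I : ℕ
    D A : Bool
    I = incPrefix (x ∷ y ∷ u ++ [ M ])
    D = decPrefix (x ∷ y ∷ u) ≤ᵇ k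
    A = runsOK (y ∷ u)
    goal : Set
    goal = (I ≤ᵇ k) ∧ D ∧ (A ∧ (suc (finalIncRun (y ∷ u)) ≤ᵇ k))
         ≡ ((incPrefix (x ∷ y ∷ u) ≤ᵇ k) ∧ D ∧ A) ∧ (suc (finalIncRun (x ∷ y ∷ u)) ≤ᵇ k)
    by-chain : ∀ c → chain _<ᵣ_ (x ∷ y ∷ u) ≡ c → goal
    by-chain true  inc
      rewrite incPrefix-chain-max (x ∷ y ∷ u) M x∷y∷u<M inc | monoPrefix-chain _<ᵣ_ (x ∷ y ∷ u) inc
            | finalIncRun-chain (x ∷ y ∷ u) inc | finalIncRun-chain (y ∷ u) (∧-trueʳ inc) =
      ∧-solve 4 (λ a b c d → a ⊕ b ⊕ (c ⊕ d) ⊜ (d ⊕ b ⊕ c) ⊕ a) refl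
        (suc (length (x ∷ y ∷ u)) ≤ᵇ k) D A (length (x ∷ y ∷ u) ≤ᵇ k)
    by-chain false ninc
      rewrite monoPrefix-++ _<ᵣ_ (x ∷ y ∷ u) [ M ] ninc | finalIncRun-cons x (y ∷ u) ninc =
      ∧-solve 4 (λ a b c d → a ⊕ b ⊕ (c ⊕ d) ⊜ (a ⊕ b ⊕ c) ⊕ d) refl
        (incPrefix (x ∷ y ∷ u) ≤ᵇ k) D A (suc (finalIncRun (y ∷ u)) ≤ᵇ k)

  runsOK-starting-at-max : ∀ M τ → All (_< M) τ → τ ≢ [] →
                           runsOK (M ∷ τ) ≡ (suc (decPrefix τ) ≤ᵇ k) ∧ runsOK τ
  runsOK-starting-at-max M τ τ<M τ≢[]
    rewrite incPrefix-from-max M τ τ<M | decPrefix-from-max M τ τ<M τ≢[] | ≤ᵇ-true 1≤k = refl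

  adm : ℕ → ℕ → List ℕ → Bool
  adm = admissible k

  ≤ᵇ-weaken : ∀ a {i} → i ≤ k → (a ≤ᵇ i) ≡ true → (a ≤ᵇ k) ≡ true
  ≤ᵇ-weaken a {i} i≤k a≤i = ≤ᵇ-true (≤-trans (≤ᵇ⇒≤ a i (subst T (sym a≤i) _)) i≤k)

  adm-single : ∀ i j M → 1 ≤ i → 1 ≤ j → adm i j [ M ] ≡ true
  adm-single i j M 1≤i 1≤j rewrite ≤ᵇ-true 1≤k | ≤ᵇ-true 1≤i | ≤ᵇ-true 1≤j = refl

  -- M in front: the initial decreasing run gets one longer
  adm-starting-at-max : ∀ i j M τ → 1 ≤ i → i ≤ k → All (_< M) τ → τ ≢ [] →
                        adm i j (M ∷ τ) ≡ adm (i ∸ 1) j τ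
  adm-starting-at-max i j M τ 1≤i i≤k τ<M τ≢[]
    rewrite runsOK-starting-at-max M τ τ<M τ≢[] | decPrefix-from-max M τ τ<M τ≢[]
          | finalIncRun-after-max [] M τ τ<M τ≢[] = begin
    (Y ∧ A) ∧ Z ∧ F   ≡⟨ ∧-solve 4 (λ y a z f → (y ⊕ a) ⊕ z ⊕ f ⊜ a ⊕ (y ⊕ z) ⊕ f) refl Y A Z F ⟩
    A ∧ (Y ∧ Z) ∧ F   ≡⟨ cong (λ b → A ∧ b ∧ F) (∧-absorbˡ Y Z (≤ᵇ-weaken (suc d) i≤k)) ⟩
    A ∧ Z ∧ F         ≡⟨ cong (λ b → A ∧ b ∧ F) (suc≤ᵇ d i 1≤i) ⟩
    adm (i ∸ 1) j τ   ∎
    where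
    open ≡-Reasoning
    d : ℕ
    A Y Z F : Bool
    d = decPrefix τ
    A = runsOK τ
    Y = suc d ≤ᵇ k
    Z = suc d ≤ᵇ i
    F = finalIncRun τ ≤ᵇ j

  -- M at the end: the final increasing run gets one longer
  adm-ending-at-max : ∀ i j σ M → 1 ≤ j → j ≤ k → All (_< M) σ → σ ≢ [] →
                      adm i j (σ ++ [ M ]) ≡ adm i (j ∸ 1) σ
  adm-ending-at-max i j σ M 1≤j j≤k σ<M σ≢[]
    rewrite runsOK-ending-at-max σ M σ<M σ≢[] | decPrefix-before-max σ M [] σ<M σ≢[]
          | finalIncRun-at-max σ M σ<M σ≢[] = begin
    (A ∧ Y) ∧ I ∧ Z   ≡⟨ ∧-solve 4 (λ a y i z → (a ⊕ y) ⊕ i ⊕ z ⊜ a ⊕ i ⊕ (y ⊕ z)) refl A Y I Z ⟩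
    A ∧ I ∧ (Y ∧ Z)   ≡⟨ cong (λ b → A ∧ I ∧ b) (∧-absorbˡ Y Z (≤ᵇ-weaken (suc f) j≤k)) ⟩
    A ∧ I ∧ Z         ≡⟨ cong (λ b → A ∧ I ∧ b) (suc≤ᵇ f j 1≤j) ⟩
    adm i (j ∸ 1) σ   ∎
    where
    open ≡-Reasoning
    f : ℕ
    A Y I Z : Bool
    f = finalIncRun σ
    A = runsOK σ
    Y = suc f ≤ᵇ k
    I = decPrefix σ ≤ᵇ i
    Z = suc f ≤ᵇ j

  -- M strictly inside: σ must end, and τ must start, with a run of length < k
  adm-around-max : ∀ i j σ M τ → All (_< M) σ → All (_< M) τ → σ ≢ [] → τ ≢ [] →
                   adm i j (σ ++ M ∷ τ) ≡ adm i (k ∸ 1) σ ∧ adm (k ∸ 1) j τ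
  adm-around-max i j σ M τ σ<M τ<M σ≢[] τ≢[]
    rewrite runsOK-split σ M τ σ<M τ<M | runsOK-ending-at-max σ M σ<M σ≢[]
          | runsOK-starting-at-max M τ τ<M τ≢[] | decPrefix-before-max σ M τ σ<M σ≢[]
          | finalIncRun-after-max σ M τ τ<M τ≢[] = begin
    ((Aσ ∧ Fσ) ∧ (Dτ ∧ Aτ)) ∧ Iσ ∧ Jτ
      ≡⟨ ∧-solve 6 (λ a f d b i j → ((a ⊕ f) ⊕ (d ⊕ b)) ⊕ i ⊕ j ⊜ (a ⊕ i ⊕ f) ⊕ (b ⊕ d ⊕ j))
               refl Aσ Fσ Dτ Aτ Iσ Jτ ⟩
    (Aσ ∧ Iσ ∧ Fσ) ∧ (Aτ ∧ Dτ ∧ Jτ)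
      ≡⟨ cong₂ (λ p q → (Aσ ∧ Iσ ∧ p) ∧ (Aτ ∧ q ∧ Jτ)) (suc≤ᵇ (finalIncRun σ) k 1≤k)
                                                       (suc≤ᵇ (decPrefix τ) k 1≤k) ⟩
    adm i (k ∸ 1) σ ∧ adm (k ∸ 1) j τ ∎
    where
    open ≡-Reasoning
    Aσ Aτ Fσ Dτ Iσ Jτ : Bool
    Aσ = runsOK σ
    Aτ = runsOK τ
    Fσ = suc (finalIncRun σ) ≤ᵇ k
    Dτ = suc (decPrefix τ) ≤ᵇ k
    Iσ = decPrefix σ ≤ᵇ i
    Jτ = finalIncRun τ ≤ᵇ j

  decPrefix-pos : ∀ w → w ≢ [] → (decPrefix w ≤ᵇ 0) ≡ false
  decPrefix-pos []          w≢[] = ⊥-elim (w≢[] refl)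
  decPrefix-pos (x ∷ [])    _    = refl
  decPrefix-pos (x ∷ y ∷ w) _    with y <ᵇ x
  ... | true  = refl
  ... | false = refl

  adm-i=0 : ∀ j w → w ≢ [] → adm 0 j w ≡ false
  adm-i=0 j w w≢[] rewrite decPrefix-pos w w≢[] = ∧-zeroʳ (runsOK w)

  adm-j=0 : ∀ i w → w ≢ [] → adm i 0 w ≡ false
  adm-j=0 i w w≢[] rewrite decPrefix-pos (reverse w) (reverse-≢[] w w≢[]) =
    trans (cong (runsOK w ∧_) (∧-zeroʳ (decPrefix w ≤ᵇ i))) (∧-zeroʳ (runsOK w))


count : ∀ {A : Set} → (A → Bool) → List A → ℕ
count p []       = 0
count p (x ∷ xs) = (if p x then 1 else 0) + count p xs

count-filterᵇ : ∀ {A : Set} (p : A → Bool) xs → length (filterᵇ p xs) ≡ count p xs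
count-filterᵇ p []       = refl
count-filterᵇ p (x ∷ xs) with p x
... | true  = cong suc (count-filterᵇ p xs)
... | false = count-filterᵇ p xs

count-++ : ∀ {A : Set} (p : A → Bool) xs ys → count p (xs ++ ys) ≡ count p xs + count p ys
count-++ p []       ys = refl
count-++ p (x ∷ xs) ys =
  trans (cong (_ +_) (count-++ p xs ys)) (sym (+-assoc (if p x then 1 else 0) (count p xs) (count p ys)))

count-map : ∀ {A B : Set} (p : B → Bool) (f : A → B) xs → count p (map f xs) ≡ count (λ x → p (f x)) xs
count-map p f []       = refl
count-map p f (x ∷ xs) = cong (_ +_) (count-map p f xs)

count-concatMap : ∀ {A B : Set} (p : B → Bool) (f : A → List B) xs →
                  count p (concatMap f xs) ≡ sum (map (λ x → count p (f x)) xs)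
count-concatMap p f []       = refl
count-concatMap p f (x ∷ xs) =
  trans (count-++ p (f x) (concatMap f xs)) (cong (count p (f x) +_) (count-concatMap p f xs))

count-cong : ∀ {A : Set} (p q : A → Bool) xs → (∀ {x} → x ∈ xs → p x ≡ q x) → count p xs ≡ count q xs
count-cong p q []       _    = refl
count-cong p q (x ∷ xs) p≡q =
  cong₂ _+_ (cong (λ b → if b then 1 else 0) (p≡q (here refl))) (count-cong p q xs (λ x∈xs → p≡q (there x∈xs)))

count-false : ∀ {A : Set} (xs : List A) → count (λ _ → false) xs ≡ 0
count-false []       = refl
count-false (x ∷ xs) = count-false xs

count-pairs : ∀ {A B : Set} (p : A → Bool) (q : B → Bool) xs ys →
              sum (map (λ x → count (λ y → p x ∧ q y) ys) xs) ≡ count p xs * count q ys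
count-pairs p q []       ys = refl
count-pairs p q (x ∷ xs) ys with p x
... | true  = cong (count q ys +_) (count-pairs p q xs ys)
... | false = trans (cong (_+ sum (map (λ x → count (λ y → p x ∧ q y) ys) xs)) (count-false ys))
                    (count-pairs p q xs ys)

sum-cong : ∀ {A : Set} (f g : A → ℕ) xs → (∀ {x} → x ∈ xs → f x ≡ g x) → sum (map f xs) ≡ sum (map g xs)
sum-cong f g xs f≡g = cong sum (map-cong-local (All.tabulate f≡g))

count-same-members : ∀ {A : Set} (p : A → Bool) xs ys → Unique xs → Unique ys →
                     (∀ {v} → v ∈ xs → v ∈ ys) → (∀ {v} → v ∈ ys → v ∈ xs) → count p xs ≡ count p ys
count-same-members p xs ys ux uy xs⊆ys ys⊆xs = begin
  count p xs                ≡⟨ count-filterᵇ p xs ⟨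
  length (filterᵇ p xs)     ≡⟨ ↭-length (filter-↭ _ (∼bag⇒↭ (unique∧set⇒bag ux uy (mk⇔ xs⊆ys ys⊆xs)))) ⟩
  length (filterᵇ p ys)     ≡⟨ count-filterᵇ p ys ⟩
  count p ys                ∎
  where open ≡-Reasoning

sum-count-single : ∀ {A B : Set} (p : A → B → Bool) y xs →
                   sum (map (λ x → count (p x) (y ∷ [])) xs) ≡ count (λ x → p x y) xs
sum-count-single p y []       = refl
sum-count-single p y (x ∷ xs) =
  trans (cong (_+ _) (+-identityʳ (if p x y then 1 else 0))) (cong (_ +_) (sum-count-single p y xs))

count-none : ∀ {A : Set} (p : A → Bool) xs → (∀ {x} → x ∈ xs → p x ≡ false) → count p xs ≡ 0
count-none p xs none = trans (count-cong p (λ _ → false) xs none) (count-false xs)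


remove : ℕ → List ℕ → List ℕ
remove x = filter (λ z → ¬? (z ≟ x))

∈-remove : ∀ {x y} v → y ∈ v → ¬ y ≡ x → y ∈ remove x v
∈-remove v y∈v y≢x = ∈-filter⁺ _ y∈v y≢x

length-remove : ∀ {x} v → x ∈ v → suc (length (remove x v)) ≤ length v
length-remove v x∈v = filter-notAll _ v (Any.map (λ { refl z≢z → z≢z refl }) x∈v)

unique-⊆⇒≤ : ∀ (u v : List ℕ) → Unique u → (∀ {x} → x ∈ u → x ∈ v) → length u ≤ length v
unique-⊆⇒≤ []      v _             _   = z≤n
unique-⊆⇒≤ (x ∷ u) v uu@(_ ∷ u-uniq) u⊆v =
  ≤-trans (s≤s (unique-⊆⇒≤ u (remove x v) u-uniq u⊆v−x)) (length-remove v (u⊆v (here refl)))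
  where
  u⊆v−x : ∀ {y} → y ∈ u → y ∈ remove x v
  u⊆v−x {y} y∈u = ∈-remove v (u⊆v (there y∈u)) (λ { refl → Unique[x∷xs]⇒x∉xs uu y∈u })

unique-⊆-full : ∀ (u v : List ℕ) → Unique u → (∀ {x} → x ∈ u → x ∈ v) → length v ≤ length u →
                ∀ {y} → y ∈ v → y ∈ u
unique-⊆-full u v uu u⊆v |v|≤|u| {y} y∈v with y ∈? u
... | yes y∈u = y∈u
... | no  y∉u = ⊥-elim (<-irrefl refl (≤-<-trans |v|≤|u| |u|<|v|))
  where
  u⊆v−y : ∀ {z} → z ∈ u → z ∈ remove y v
  u⊆v−y {z} z∈u = ∈-remove v (u⊆v z∈u) (λ { refl → y∉u z∈u })
  |u|<|v| : suc (length u) ≤ length v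
  |u|<|v| = ≤-trans (s≤s (unique-⊆⇒≤ u (remove y v) uu u⊆v−y)) (length-remove v y∈v)


-- strictly decreasing lists; they serve as finite sets of numbers
Descending : List ℕ → Set
Descending = AllPairs _>_

descending-unique : ∀ {S} → Descending S → Unique S
descending-unique = AllPairs.map >⇒≢

masks : ℕ → List (List Bool)
masks zero    = [] ∷ []
masks (suc n) = map (true ∷_) (masks n) ++ map (false ∷_) (masks n)

masks-length : ∀ n {b} → b ∈ masks n → length b ≡ n
masks-length zero    (here refl) = refl
masks-length (suc n) b∈ with ∈-++⁻ (map (true ∷_) (masks n)) b∈
... | inj₁ b∈ᵗ with _ , c∈ , refl ← ∈-map⁻ (true ∷_) b∈ᵗ  = cong suc (masks-length n c∈)
... | inj₂ b∈ᶠ with _ , c∈ , refl ← ∈-map⁻ (false ∷_) b∈ᶠ = cong suc (masks-length n c∈)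

masks-complete : ∀ b → b ∈ masks (length b)
masks-complete []          = here refl
masks-complete (true ∷ b)  = ∈-++⁺ˡ (∈-map⁺ (true ∷_) (masks-complete b))
masks-complete (false ∷ b) = ∈-++⁺ʳ (map (true ∷_) (masks (length b))) (∈-map⁺ (false ∷_) (masks-complete b))

masks-unique : ∀ n → Unique (masks n)
masks-unique zero    = [] ∷ []
masks-unique (suc n) = ++⁺ (map⁺ ∷-injectiveʳ (masks-unique n)) (map⁺ ∷-injectiveʳ (masks-unique n)) disjoint
  where
  disjoint : ∀ {b} → ¬ (b ∈ map (true ∷_) (masks n) × b ∈ map (false ∷_) (masks n))
  disjoint (bᵗ , bᶠ) with _ , _ , refl ← ∈-map⁻ (true ∷_) bᵗ | _ , _ , () ← ∈-map⁻ (false ∷_) bᶠ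

pick : List Bool → List ℕ → List ℕ
pick []          _       = []
pick (_ ∷ _)     []      = []
pick (true ∷ b)  (x ∷ S) = x ∷ pick b S
pick (false ∷ b) (x ∷ S) = pick b S

complement : List Bool → List Bool
complement = map not

trues : List Bool → ℕ
trues = count (λ x → x)

pick-⊆ : ∀ b S {x} → x ∈ pick b S → x ∈ S
pick-⊆ (true ∷ b)  (y ∷ S) (here x≡y) = here x≡y
pick-⊆ (true ∷ b)  (y ∷ S) (there x∈) = there (pick-⊆ b S x∈)
pick-⊆ (false ∷ b) (y ∷ S) x∈         = there (pick-⊆ b S x∈)

pick-All : ∀ {P : ℕ → Set} b S → All P S → All P (pick b S)
pick-All b S ps = All.tabulate (λ x∈ → All.lookup ps (pick-⊆ b S x∈))

pick-descending : ∀ b S → Descending S → Descending (pick b S)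
pick-descending []          S       _          = []
pick-descending (_ ∷ _)     []      _          = []
pick-descending (true ∷ b)  (x ∷ S) (x>S ∷ dS) = pick-All b S x>S ∷ pick-descending b S dS
pick-descending (false ∷ b) (x ∷ S) (_   ∷ dS) = pick-descending b S dS

pick-cover : ∀ b S {x} → length b ≡ length S → x ∈ S → x ∈ pick b S ⊎ x ∈ pick (complement b) S
pick-cover (true ∷ b)  (y ∷ S) _  (here x≡y) = inj₁ (here x≡y)
pick-cover (false ∷ b) (y ∷ S) _  (here x≡y) = inj₂ (here x≡y)
pick-cover (true ∷ b)  (y ∷ S) eq (there x∈) with pick-cover b S (suc-injective eq) x∈
... | inj₁ x∈ᵇ = inj₁ (there x∈ᵇ)
... | inj₂ x∈ᶜ = inj₂ x∈ᶜ
pick-cover (false ∷ b) (y ∷ S) eq (there x∈) with pick-cover b S (suc-injective eq) x∈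
... | inj₁ x∈ᵇ = inj₁ x∈ᵇ
... | inj₂ x∈ᶜ = inj₂ (there x∈ᶜ)

pick-disjoint : ∀ b S {x} → Unique S → x ∈ pick b S → x ∈ pick (complement b) S → ⊥
pick-disjoint (true ∷ b)  (y ∷ S) uS         (here refl) x∈ᶜ        = Unique[x∷xs]⇒x∉xs uS (pick-⊆ (complement b) S x∈ᶜ)
pick-disjoint (true ∷ b)  (y ∷ S) (_ ∷ uS)   (there x∈ᵇ) x∈ᶜ        = pick-disjoint b S uS x∈ᵇ x∈ᶜ
pick-disjoint (false ∷ b) (y ∷ S) uS         x∈ᵇ         (here refl) = Unique[x∷xs]⇒x∉xs uS (pick-⊆ b S x∈ᵇ)
pick-disjoint (false ∷ b) (y ∷ S) (_ ∷ uS)   x∈ᵇ         (there x∈ᶜ) = pick-disjoint b S uS x∈ᵇ x∈ᶜ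

pick-length : ∀ b S → length b ≡ length S → length (pick b S) ≡ trues b
pick-length []          []      _  = refl
pick-length (true ∷ b)  (x ∷ S) eq = cong suc (pick-length b S (suc-injective eq))
pick-length (false ∷ b) (x ∷ S) eq = pick-length b S (suc-injective eq)

pick-≤ : ∀ b S → length (pick b S) ≤ length S
pick-≤ []          S       = z≤n
pick-≤ (_ ∷ _)     []      = z≤n
pick-≤ (true ∷ b)  (x ∷ S) = s≤s (pick-≤ b S)
pick-≤ (false ∷ b) (x ∷ S) = ≤-trans (pick-≤ b S) (n≤1+n _)

∈-pick-by⁺ : ∀ (p : ℕ → Bool) S {x} → x ∈ S → p x ≡ true → x ∈ pick (map p S) S
∈-pick-by⁺ p (y ∷ S) (here refl) px rewrite px = here refl
∈-pick-by⁺ p (y ∷ S) (there x∈)  px with p y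
... | true  = there (∈-pick-by⁺ p S x∈ px)
... | false = ∈-pick-by⁺ p S x∈ px

∈-pick-by⁻ : ∀ (p : ℕ → Bool) S {x} → x ∈ pick (map p S) S → p x ≡ true
∈-pick-by⁻ p (y ∷ S) x∈ with p y in py
∈-pick-by⁻ p (y ∷ S) (here refl) | true  = py
∈-pick-by⁻ p (y ∷ S) (there x∈)  | true  = ∈-pick-by⁻ p S x∈
∈-pick-by⁻ p (y ∷ S) x∈          | false = ∈-pick-by⁻ p S x∈


unique-++⁻ˡ : ∀ {A : Set} (xs : List A) {ys} → Unique (xs ++ ys) → Unique xs
unique-++⁻ˡ []       _         = []
unique-++⁻ˡ (x ∷ xs) (x∉ ∷ u) = All.tabulate (λ y∈xs → All.lookup x∉ (∈-++⁺ˡ y∈xs)) ∷ unique-++⁻ˡ xs u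

unique-++⁻ʳ : ∀ {A : Set} (xs : List A) {ys} → Unique (xs ++ ys) → Unique ys
unique-++⁻ʳ []       u       = u
unique-++⁻ʳ (x ∷ xs) (_ ∷ u) = unique-++⁻ʳ xs u

unique-++-disjoint : ∀ {A : Set} (xs : List A) {ys v} → Unique (xs ++ ys) → v ∈ xs → v ∉ ys
unique-++-disjoint (x ∷ xs) (x∉ ∷ _) (here refl) v∈ys = All.lookup x∉ (∈-++⁺ʳ xs v∈ys) refl
unique-++-disjoint (x ∷ xs) (_ ∷ u)  (there v∈)  v∈ys = unique-++-disjoint xs u v∈ v∈ys

unique-∷ : ∀ {A : Set} {x : A} {xs} → x ∉ xs → Unique xs → Unique (x ∷ xs)
unique-∷ {xs = xs} x∉xs u = Allₚ.¬Any⇒All¬ xs x∉xs ∷ u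

unique-concatMap : ∀ {A B : Set} (f : A → List B) (key : B → A) xs → Unique xs →
                   (∀ {x} → x ∈ xs → Unique (f x)) → (∀ {x y} → x ∈ xs → y ∈ f x → key y ≡ x) →
                   Unique (concatMap f xs)
unique-concatMap f key []       _            _  _   = []
unique-concatMap f key (x ∷ xs) ux@(_ ∷ uxs) uf key≡ =
  ++⁺ (uf (here refl)) (unique-concatMap f key xs uxs (λ x∈ → uf (there x∈)) (λ x∈ → key≡ (there x∈))) disjoint
  where
  disjoint : ∀ {y} → ¬ (y ∈ f x × y ∈ concatMap f xs)
  disjoint (y∈fx , y∈rest) with _ , x′∈xs , y∈fx′ ← find (∈-concatMap⁻ f y∈rest) =
    Unique[x∷xs]⇒x∉xs ux (subst (_∈ xs) (trans (sym (key≡ (there x′∈xs) y∈fx′)) (key≡ (here refl) y∈fx)) x′∈xs)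


-- Arrangements of a set, generated by the position of the largest element

record IsArrangement (S w : List ℕ) : Set where
  field
    unique : Unique w
    sound  : ∀ {x} → x ∈ w → x ∈ S
    full   : ∀ {x} → x ∈ S → x ∈ w
open IsArrangement

-- For a descending list M ∷ S, every arrangement is σ M τ where σ and τ
-- arrange complementary parts of S, described by a mask b.  The fuel f
-- (at least the length of S) makes the recursion structural.
arrangements : ℕ → List ℕ → List (List ℕ)
withMask     : ℕ → ℕ → List ℕ → List Bool → List (List ℕ)
withPrefix   : ℕ → ℕ → List ℕ → List Bool → List ℕ → List (List ℕ)

arrangements f       []      = [ [] ]
arrangements zero    (_ ∷ _) = []
arrangements (suc f) (M ∷ S) = concatMap (withMask f M S) (masks (length S))
withMask   f M S b   = concatMap (withPrefix f M S b) (arrangements f (pick b S))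
withPrefix f M S b σ = map (λ τ → σ ++ M ∷ τ) (arrangements f (pick (complement b) S))

record Decomposition (f M : ℕ) (S w : List ℕ) : Set where
  field
    mask      : List Bool
    left      : List ℕ
    right     : List ℕ
    mask∈     : mask ∈ masks (length S)
    left∈     : left ∈ arrangements f (pick mask S)
    right∈    : right ∈ arrangements f (pick (complement mask) S)
    w≡        : w ≡ left ++ M ∷ right

decompose : ∀ f M S {w} → w ∈ arrangements (suc f) (M ∷ S) → Decomposition f M S w
decompose f M S w∈
  with b , b∈ , w∈₁ ← find (∈-concatMap⁻ (withMask f M S) w∈)
  with σ , σ∈ , w∈₂ ← find (∈-concatMap⁻ (withPrefix f M S b) w∈₁)
  with τ , τ∈ , w≡  ← ∈-map⁻ (λ τ → σ ++ M ∷ τ) w∈₂ = record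
  { mask = b ; left = σ ; right = τ ; mask∈ = b∈ ; left∈ = σ∈ ; right∈ = τ∈ ; w≡ = w≡ }

∈-arrangements : ∀ f M S {b σ τ} → b ∈ masks (length S) → σ ∈ arrangements f (pick b S) →
                 τ ∈ arrangements f (pick (complement b) S) → σ ++ M ∷ τ ∈ arrangements (suc f) (M ∷ S)
∈-arrangements f M S {b} {σ} b∈ σ∈ τ∈ =
  ∈-concatMap⁺ (withMask f M S) (lose b∈ (∈-concatMap⁺ (withPrefix f M S b) (lose σ∈ (∈-map⁺ (λ τ → σ ++ M ∷ τ) τ∈))))

pick-invariant : ∀ {f} b S → Descending S → length S ≤ f → Descending (pick b S) × length (pick b S) ≤ f
pick-invariant b S dS |S|≤f = pick-descending b S dS , ≤-trans (pick-≤ b S) |S|≤f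

max∉ : ∀ {M S} → All (M >_) S → M ∉ S
max∉ M>S M∈S = <-irrefl refl (All.lookup M>S M∈S)

arrangements-sound : ∀ f S → Descending S → length S ≤ f → ∀ {w} → w ∈ arrangements f S → IsArrangement S w
arrangements-sound f       []      _          _          (here refl) = record { unique = [] ; sound = λ () ; full = λ () }
arrangements-sound (suc f) (M ∷ S) (M>S ∷ dS) (s≤s |S|≤f) w∈ with decompose f M S w∈
... | record { mask = b ; left = σ ; right = τ ; mask∈ = b∈ ; left∈ = σ∈ ; right∈ = τ∈ ; w≡ = refl } =
  record { unique = unique-w ; sound = sound-w ; full = full-w }
  where
  arrangement-of : ∀ b {v} → v ∈ arrangements f (pick b S) → IsArrangement (pick b S) v
  arrangement-of b = let d , l = pick-invariant b S dS |S|≤f in arrangements-sound f (pick b S) d l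
  σ-arr : IsArrangement (pick b S) σ
  σ-arr = arrangement-of b σ∈
  τ-arr : IsArrangement (pick (complement b) S) τ
  τ-arr = arrangement-of (complement b) τ∈
  σ⊆S : ∀ {x} → x ∈ σ → x ∈ S
  σ⊆S x∈ = pick-⊆ b S (sound σ-arr x∈)
  τ⊆S : ∀ {x} → x ∈ τ → x ∈ S
  τ⊆S x∈ = pick-⊆ (complement b) S (sound τ-arr x∈)
  unique-w : Unique (σ ++ M ∷ τ)
  unique-w = ++⁺ (unique σ-arr) (unique-∷ (λ M∈τ → max∉ M>S (τ⊆S M∈τ)) (unique τ-arr)) disjoint
    where
    disjoint : ∀ {v} → ¬ (v ∈ σ × v ∈ M ∷ τ)
    disjoint (v∈σ , here refl) = max∉ M>S (σ⊆S v∈σ)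
    disjoint (v∈σ , there v∈τ) =
      pick-disjoint b S (descending-unique dS) (sound σ-arr v∈σ) (sound τ-arr v∈τ)
  sound-w : ∀ {x} → x ∈ σ ++ M ∷ τ → x ∈ M ∷ S
  sound-w x∈ with ∈-++⁻ σ x∈
  ... | inj₁ x∈σ         = there (σ⊆S x∈σ)
  ... | inj₂ (here x≡M)  = here x≡M
  ... | inj₂ (there x∈τ) = there (τ⊆S x∈τ)
  full-w : ∀ {x} → x ∈ M ∷ S → x ∈ σ ++ M ∷ τ
  full-w (here x≡M) = ∈-++⁺ʳ σ (here x≡M)
  full-w (there x∈S) with pick-cover b S (masks-length (length S) b∈) x∈S
  ... | inj₁ x∈ᵇ = ∈-++⁺ˡ (full σ-arr x∈ᵇ)
  ... | inj₂ x∈ᶜ = ∈-++⁺ʳ σ (there (full τ-arr x∈ᶜ))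

memberMask : List ℕ → List ℕ → List Bool
memberMask σ S = map (λ x → does (x ∈? σ)) S

dec-true⁻ : ∀ {A : Set} (a? : Dec A) → does a? ≡ true → A
dec-true⁻ (yes a) _ = a

not-true : ∀ {a} → not a ≡ true → a ≡ false
not-true {false} _ = refl

arrangement-sides : ∀ {M S σ τ} → M ∉ S → IsArrangement (M ∷ S) (σ ++ M ∷ τ) →
                    IsArrangement (pick (memberMask σ S) S) σ × IsArrangement (pick (complement (memberMask σ S)) S) τ
arrangement-sides {M} {S} {σ} {τ} M∉S w-arr =
  σ-arr , subst (λ c → IsArrangement (pick c S) τ) (map-∘ S) τ-arr
  where
  inσ notInσ : ℕ → Bool
  inσ x    = does (x ∈? σ)
  notInσ x = not (inσ x)
  uw : Unique (σ ++ M ∷ τ)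
  uw = unique w-arr
  M∉σ : M ∉ σ
  M∉σ M∈σ = unique-++-disjoint σ uw M∈σ (here refl)
  M∉τ : M ∉ τ
  M∉τ = Unique[x∷xs]⇒x∉xs (unique-++⁻ʳ σ uw)
  σ∩τ : ∀ {x} → x ∈ σ → x ∉ τ
  σ∩τ x∈σ x∈τ = unique-++-disjoint σ uw x∈σ (there x∈τ)
  in-S : ∀ {x} → x ∈ σ ++ M ∷ τ → x ≢ M → x ∈ S
  in-S x∈w x≢M with sound w-arr x∈w
  ... | here x≡M  = ⊥-elim (x≢M x≡M)
  ... | there x∈S = x∈S
  σ-arr : IsArrangement (pick (map inσ S) S) σ
  σ-arr = record
    { unique = unique-++⁻ˡ σ uw
    ; sound  = λ x∈σ → ∈-pick-by⁺ inσ S (in-S (∈-++⁺ˡ x∈σ) (λ { refl → M∉σ x∈σ })) (dec-true (_ ∈? σ) x∈σ)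
    ; full   = λ x∈ → dec-true⁻ (_ ∈? σ) (∈-pick-by⁻ inσ S x∈)
    }
  full-τ : ∀ {x} → x ∈ pick (map notInσ S) S → x ∈ τ
  full-τ {x} x∈ with ∈-++⁻ σ (full w-arr (there (pick-⊆ (map notInσ S) S x∈)))
  ... | inj₁ x∈σ         with () ← trans (sym (dec-true (x ∈? σ) x∈σ)) (not-true (∈-pick-by⁻ notInσ S x∈))
  ... | inj₂ (here refl) = ⊥-elim (M∉S (pick-⊆ (map notInσ S) S x∈))
  ... | inj₂ (there x∈τ) = x∈τ
  τ-arr : IsArrangement (pick (map notInσ S) S) τ
  τ-arr = record
    { unique = AllPairs.tail (unique-++⁻ʳ σ uw)
    ; sound  = λ x∈τ → ∈-pick-by⁺ notInσ S (in-S (∈-++⁺ʳ σ (there x∈τ)) (λ { refl → M∉τ x∈τ }))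
                                          (cong not (dec-false (_ ∈? σ) (λ x∈σ → σ∩τ x∈σ x∈τ)))
    ; full   = full-τ
    }

-- every arrangement of S is generated: split it at M and recurse on both sides
arrangements-complete : ∀ f S → Descending S → length S ≤ f → ∀ {w} → IsArrangement S w → w ∈ arrangements f S
arrangements-complete f       []      _          _           {[]}    _ = here refl
arrangements-complete f       []      _          _           {x ∷ w} w-arr with () ← sound w-arr (here refl)
arrangements-complete (suc f) (M ∷ S) (M>S ∷ dS) (s≤s |S|≤f) {w}     w-arr
  with σ , τ , refl   ← ∈-∃++ (full w-arr (here refl))
  with σ-arr , τ-arr ← arrangement-sides (max∉ M>S) w-arr =
  ∈-arrangements f M S b∈ (recurse b σ-arr) (recurse (complement b) τ-arr)
  where
  b : List Bool
  b = memberMask σ S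
  b∈ : b ∈ masks (length S)
  b∈ = subst (λ n → b ∈ masks n) (length-map _ S) (masks-complete b)
  recurse : ∀ b {v} → IsArrangement (pick b S) v → v ∈ arrangements f (pick b S)
  recurse b = let d , l = pick-invariant b S dS |S|≤f in arrangements-complete f (pick b S) d l

before : ℕ → List ℕ → List ℕ
before M []      = []
before M (x ∷ w) with x ≟ M
... | yes _ = []
... | no  _ = x ∷ before M w

before-around : ∀ σ M τ → M ∉ σ → before M (σ ++ M ∷ τ) ≡ σ
before-around []      M τ _   with M ≟ M
... | yes _   = refl
... | no  M≢M = ⊥-elim (M≢M refl)
before-around (x ∷ σ) M τ M∉ with x ≟ M
... | yes refl = ⊥-elim (M∉ (here refl))
... | no  _    = cong (x ∷_) (before-around σ M τ (λ M∈σ → M∉ (there M∈σ)))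

memberMask-pick : ∀ S b σ → Unique S → length b ≡ length S →
                  (∀ {x} → x ∈ S → x ∈ σ → x ∈ pick b S) → (∀ {x} → x ∈ pick b S → x ∈ σ) →
                  memberMask σ S ≡ b
memberMask-pick []      []          σ _            _  _      _      = refl
memberMask-pick (y ∷ S) (true ∷ b)  σ uS@(_ ∷ uS′) eq σ⊆pick pick⊆σ =
  cong₂ _∷_ (dec-true (y ∈? σ) (pick⊆σ (here refl)))
            (memberMask-pick S b σ uS′ (suc-injective eq) σ⊆pickᵗ (λ x∈ → pick⊆σ (there x∈)))
  where
  σ⊆pickᵗ : ∀ {x} → x ∈ S → x ∈ σ → x ∈ pick b S
  σ⊆pickᵗ x∈S x∈σ with σ⊆pick (there x∈S) x∈σ
  ... | here refl = ⊥-elim (Unique[x∷xs]⇒x∉xs uS x∈S)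
  ... | there x∈  = x∈
memberMask-pick (y ∷ S) (false ∷ b) σ uS@(_ ∷ uS′) eq σ⊆pick pick⊆σ =
  cong₂ _∷_ (dec-false (y ∈? σ) (λ y∈σ → Unique[x∷xs]⇒x∉xs uS (pick-⊆ b S (σ⊆pick (here refl) y∈σ))))
            (memberMask-pick S b σ uS′ (suc-injective eq) (λ x∈S → σ⊆pick (there x∈S)) pick⊆σ)

-- no arrangement is generated twice: the word determines σ, hence the mask
arrangements-unique : ∀ f S → Descending S → length S ≤ f → Unique (arrangements f S)
arrangements-unique f       []      _          _           = [] ∷ []
arrangements-unique (suc f) (M ∷ S) (M>S ∷ dS) (s≤s |S|≤f) =
  unique-concatMap (withMask f M S) maskOf (masks (length S)) (masks-unique (length S)) unique-withMask maskOf≡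
  where
  maskOf : List ℕ → List Bool
  maskOf w = memberMask (before M w) S
  recurse : ∀ b → Unique (arrangements f (pick b S))
  recurse b = let d , l = pick-invariant b S dS |S|≤f in arrangements-unique f (pick b S) d l
  arrangement-of : ∀ b {σ} → σ ∈ arrangements f (pick b S) → IsArrangement (pick b S) σ
  arrangement-of b = let d , l = pick-invariant b S dS |S|≤f in arrangements-sound f (pick b S) d l
  M∉ : ∀ b {σ} → σ ∈ arrangements f (pick b S) → M ∉ σ
  M∉ b σ∈ M∈σ = max∉ M>S (pick-⊆ b S (sound (arrangement-of b σ∈) M∈σ))
  before≡ : ∀ b {σ w} → σ ∈ arrangements f (pick b S) → w ∈ withPrefix f M S b σ → before M w ≡ σ
  before≡ b {σ} σ∈ w∈ with τ , _ , refl ← ∈-map⁻ (λ τ → σ ++ M ∷ τ) w∈ = before-around σ M τ (M∉ b σ∈)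
  unique-withMask : ∀ {b} → b ∈ masks (length S) → Unique (withMask f M S b)
  unique-withMask {b} _ = unique-concatMap (withPrefix f M S b) (before M) (arrangements f (pick b S))
    (recurse b) (λ {σ} _ → map⁺ (λ eq → ∷-injectiveʳ (++-cancelˡ σ _ _ eq)) (recurse (complement b))) (before≡ b)
  maskOf≡ : ∀ {b w} → b ∈ masks (length S) → w ∈ withMask f M S b → maskOf w ≡ b
  maskOf≡ {b} b∈ w∈ with σ , σ∈ , w∈′ ← find (∈-concatMap⁻ (withPrefix f M S b) w∈)
    rewrite before≡ b σ∈ w∈′ =
    memberMask-pick S b σ (descending-unique dS) (masks-length (length S) b∈)
      (λ _ → sound (arrangement-of b σ∈)) (full (arrangement-of b σ∈))

arrangements-fuel : ∀ f g S → length S ≤ f → length S ≤ g → arrangements f S ≡ arrangements g S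
arrangements-fuel f       g       []      _           _           = refl
arrangements-fuel (suc f) (suc g) (M ∷ S) (s≤s |S|≤f) (s≤s |S|≤g) = concatMap-cong sameMask (masks (length S))
  where
  same : ∀ b → arrangements f (pick b S) ≡ arrangements g (pick b S)
  same b = arrangements-fuel f g (pick b S) (≤-trans (pick-≤ b S) |S|≤f) (≤-trans (pick-≤ b S) |S|≤g)
  sameMask : ∀ b → withMask f M S b ≡ withMask g M S b
  sameMask b = trans (concatMap-cong (λ σ → cong (map (λ τ → σ ++ M ∷ τ)) (same (complement b)))
                                     (arrangements f (pick b S)))
                     (cong (concatMap (withPrefix g M S b)) (same b))


-- Permutations of {1,…,n} are the arrangements of n, n-1, …, 1

ranks : ℕ → List ℕ
ranks = applyDownFrom suc

ranks-descending : ∀ n → Descending (ranks n)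
ranks-descending n = applyDownFrom⁺₁ suc n (λ j<i _ → s≤s j<i)

ranks-length : ∀ n → length (ranks n) ≤ n
ranks-length n = ≤-reflexive (length-applyDownFrom suc n)

words-sound : ∀ m n {w} → w ∈ words m n → length w ≡ n × (∀ {x} → x ∈ w → x ∈ ranks m)
words-sound m zero    (here refl) = refl , λ ()
words-sound m (suc n) w∈
  with v , v∈ , w∈′   ← find (∈-concatMap⁻ (λ v → applyUpTo (λ a → suc a ∷ v) m) {xs = words m n} w∈)
  with a , a<m , refl ← ∈-applyUpTo⁻ (λ a → suc a ∷ v) w∈′ =
  cong suc (proj₁ (words-sound m n v∈)) , letters
  where
  letters : ∀ {x} → x ∈ suc a ∷ v → x ∈ ranks m
  letters (here refl) = ∈-applyDownFrom⁺ suc a<m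
  letters (there x∈v) = proj₂ (words-sound m n v∈) x∈v

words-complete : ∀ m w → (∀ {x} → x ∈ w → x ∈ ranks m) → w ∈ words m (length w)
words-complete m []      _       = here refl
words-complete m (x ∷ w) letters with a , a<m , refl ← ∈-applyDownFrom⁻ suc (letters (here refl)) =
  ∈-concatMap⁺ (λ v → applyUpTo (λ a → suc a ∷ v) m)
    (lose (words-complete m w (λ x∈w → letters (there x∈w))) (∈-applyUpTo⁺ (λ a → suc a ∷ w) a<m))

tail : List ℕ → List ℕ
tail []      = []
tail (_ ∷ w) = w

words-unique : ∀ m n → Unique (words m n)
words-unique m zero    = [] ∷ []
words-unique m (suc n) =
  unique-concatMap (λ v → applyUpTo (λ a → suc a ∷ v) m) tail (words m n) (words-unique m n)
    (λ _ → applyUpTo⁺₁ _ m (λ a<b _ eq → <-irrefl (suc-injective (∷-injectiveˡ eq)) a<b))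
    (λ {v} _ w∈ → let _ , _ , w≡ = ∈-applyUpTo⁻ (λ a → suc a ∷ v) w∈ in cong tail w≡)

perms-unique : ∀ n → Unique (perms n)
perms-unique n = filter⁺ (UniqueDec.unique? _≟_) (words-unique n n)

count-perms : ∀ (p : List ℕ → Bool) n → count p (perms n) ≡ count p (arrangements n (ranks n))
count-perms p n = count-same-members p (perms n) (arrangements n (ranks n))
  (perms-unique n) (arrangements-unique n (ranks n) (ranks-descending n) (ranks-length n)) perm⇒arr arr⇒perm
  where
  perm⇒arr : ∀ {w} → w ∈ perms n → w ∈ arrangements n (ranks n)
  perm⇒arr {w} w∈ with w∈words , uw ← ∈-filter⁻ (UniqueDec.unique? _≟_) {xs = words n n} w∈ =
    arrangements-complete n (ranks n) (ranks-descending n) (ranks-length n) record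
      { unique = uw
      ; sound  = letters
      ; full   = unique-⊆-full w (ranks n) uw letters
                   (≤-reflexive (trans (length-applyDownFrom suc n) (sym |w|≡n)))
      }
    where
    |w|≡n : length w ≡ n
    |w|≡n   = proj₁ (words-sound n n w∈words)
    letters : ∀ {x} → x ∈ w → x ∈ ranks n
    letters = proj₂ (words-sound n n w∈words)
  arr⇒perm : ∀ {w} → w ∈ arrangements n (ranks n) → w ∈ perms n
  arr⇒perm {w} w∈ = ∈-filter⁺ (UniqueDec.unique? _≟_) (subst (λ m → w ∈ words n m) |w|≡n (words-complete n w (sound w-arr)))
    (unique w-arr)
    where
    w-arr : IsArrangement (ranks n) w
    w-arr = arrangements-sound n (ranks n) (ranks-descending n) (ranks-length n) w∈
    |w|≡n : length w ≡ n
    |w|≡n = trans (≤-antisym (unique-⊆⇒≤ w (ranks n) (unique w-arr) (sound w-arr))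
                             (unique-⊆⇒≤ (ranks n) w (descending-unique (ranks-descending n)) (full w-arr)))
                  (length-applyDownFrom suc n)


Σ≤ : (ℕ → ℕ) → ℕ → ℕ
Σ≤ g zero    = g 0
Σ≤ g (suc n) = Σ≤ g n + g (suc n)

Σ≤-cong : ∀ g h n → (∀ m → m ≤ n → g m ≡ h m) → Σ≤ g n ≡ Σ≤ h n
Σ≤-cong g h zero    g≡h = g≡h 0 z≤n
Σ≤-cong g h (suc n) g≡h = cong₂ _+_ (Σ≤-cong g h n (λ m m≤n → g≡h m (≤-trans m≤n (n≤1+n n)))) (g≡h (suc n) ≤-refl)

Σ≤-first : ∀ g n → Σ≤ g (suc n) ≡ g 0 + Σ≤ (λ m → g (suc m)) n
Σ≤-first g zero    = refl
Σ≤-first g (suc n) = trans (cong (_+ g (suc (suc n))) (Σ≤-first g n)) (+-assoc (g 0) _ _)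

Σ≤-+ : ∀ g h n → Σ≤ (λ m → g m + h m) n ≡ Σ≤ g n + Σ≤ h n
Σ≤-+ g h zero    = refl
Σ≤-+ g h (suc n) = trans (cong (_+ (g (suc n) + h (suc n))) (Σ≤-+ g h n)) (interchange (Σ≤ g n) (Σ≤ h n) (g (suc n)) (h (suc n)))
  where
  interchange : ∀ a b c d → (a + b) + (c + d) ≡ (a + c) + (b + d)
  interchange a b c d = begin
    (a + b) + (c + d) ≡⟨ +-assoc a b (c + d) ⟩
    a + (b + (c + d)) ≡⟨ cong (a +_) (trans (sym (+-assoc b c d)) (trans (cong (_+ d) (+-comm b c)) (+-assoc c b d))) ⟩
    a + (c + (b + d)) ≡⟨ +-assoc a c (b + d) ⟨
    (a + c) + (b + d) ∎
    where open ≡-Reasoning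

Σ≤-zero : ∀ g n → (∀ m → m ≤ n → g m ≡ 0) → Σ≤ g n ≡ 0
Σ≤-zero g zero    g≡0 = g≡0 0 z≤n
Σ≤-zero g (suc n) g≡0 =
  cong₂ _+_ (Σ≤-zero g n (λ m m≤n → g≡0 m (≤-trans m≤n (n≤1+n n)))) (g≡0 (suc n) ≤-refl)


suc-∸ : ∀ n m → m ≤ n → suc n ∸ m ≡ suc (n ∸ m)
suc-∸ n m m≤n = +-∸-assoc 1 m≤n

-- Σ_{m≤n} C(n,m) h(m, n+1-m) = h(0, n+1) + Σ_{m≤n} C(n,m+1) h(m+1, n-m): extend the
-- sum by the vanishing term m = n+1 and shift the index
Σ≤-binomial-shift : ∀ n (h : ℕ → ℕ → ℕ) →
  Σ≤ (λ m → (n C m) * h m (suc (n ∸ m))) n ≡ h 0 (suc n) + Σ≤ (λ m → (n C suc m) * h (suc m) (n ∸ m)) n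
Σ≤-binomial-shift n h = begin
  Σ≤ (λ m → (n C m) * h m (suc (n ∸ m))) n
    ≡⟨ Σ≤-cong _ _ n (λ m m≤n → cong (λ c → (n C m) * h m c) (sym (suc-∸ n m m≤n))) ⟩
  Σ≤ (λ m → (n C m) * h m (suc n ∸ m)) n
    ≡⟨ +-identityʳ _ ⟨
  Σ≤ (λ m → (n C m) * h m (suc n ∸ m)) n + 0
    ≡⟨ cong (Σ≤ (λ m → (n C m) * h m (suc n ∸ m)) n +_)
            (cong (_* h (suc n) (n ∸ n)) (sym (k>n⇒nCk≡0 {n} {suc n} ≤-refl))) ⟩
  Σ≤ (λ m → (n C m) * h m (suc n ∸ m)) (suc n)
    ≡⟨ Σ≤-first (λ m → (n C m) * h m (suc n ∸ m)) n ⟩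
  1 * h 0 (suc n) + Σ≤ (λ m → (n C suc m) * h (suc m) (n ∸ m)) n
    ≡⟨ cong (_+ Σ≤ (λ m → (n C suc m) * h (suc m) (n ∸ m)) n) (+-identityʳ (h 0 (suc n))) ⟩
  h 0 (suc n) + Σ≤ (λ m → (n C suc m) * h (suc m) (n ∸ m)) n ∎
  where open ≡-Reasoning

-- there are C(n,m) masks of length n with m true entries
sum-masks : ∀ n (h : ℕ → ℕ → ℕ) →
            sum (map (λ b → h (trues b) (trues (complement b))) (masks n)) ≡ Σ≤ (λ m → (n C m) * h m (n ∸ m)) n
sum-masks zero    h = trans (+-identityʳ (h 0 0)) (sym (*-identityˡ (h 0 0)))
sum-masks (suc n) h = begin
  sum (map F (map (true ∷_) (masks n) ++ map (false ∷_) (masks n)))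
    ≡⟨ cong sum (map-++ F (map (true ∷_) (masks n)) (map (false ∷_) (masks n))) ⟩
  sum (map F (map (true ∷_) (masks n)) ++ map F (map (false ∷_) (masks n)))
    ≡⟨ sum-++ (map F (map (true ∷_) (masks n))) _ ⟩
  sum (map F (map (true ∷_) (masks n))) + sum (map F (map (false ∷_) (masks n)))
    ≡⟨ cong₂ _+_ (trans (cong sum (sym (map-∘ (masks n)))) (sum-masks n (λ a c → h (suc a) c)))
                 (trans (cong sum (sym (map-∘ (masks n)))) (sum-masks n (λ a c → h a (suc c)))) ⟩
  Σ≤ (λ m → (n C m) * h (suc m) (n ∸ m)) n + Σ≤ (λ m → (n C m) * h m (suc (n ∸ m))) n
    ≡⟨ cong (Σ≤ (λ m → (n C m) * h (suc m) (n ∸ m)) n +_) (Σ≤-binomial-shift n h) ⟩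
  Σ≤ (λ m → (n C m) * h (suc m) (n ∸ m)) n + (h 0 (suc n) + Σ≤ (λ m → (n C suc m) * h (suc m) (n ∸ m)) n)
    ≡⟨ regroup ⟩
  h 0 (suc n) + Σ≤ (λ m → (n C m + n C suc m) * h (suc m) (n ∸ m)) n
    ≡⟨ cong (h 0 (suc n) +_) (Σ≤-cong _ _ n (λ m _ → cong (_* h (suc m) (n ∸ m)) (nCk+nC[k+1]≡[n+1]C[k+1] n m))) ⟩
  h 0 (suc n) + Σ≤ (λ m → (suc n C suc m) * h (suc m) (n ∸ m)) n
    ≡⟨ cong (_+ Σ≤ (λ m → (suc n C suc m) * h (suc m) (n ∸ m)) n) (+-identityʳ (h 0 (suc n))) ⟨
  1 * h 0 (suc n) + Σ≤ (λ m → (suc n C suc m) * h (suc m) (suc n ∸ suc m)) n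
    ≡⟨ Σ≤-first (λ m → (suc n C m) * h m (suc n ∸ m)) n ⟨
  Σ≤ (λ m → (suc n C m) * h m (suc n ∸ m)) (suc n) ∎
  where
  open ≡-Reasoning
  F : List Bool → ℕ
  F b = h (trues b) (trues (complement b))
  regroup : Σ≤ (λ m → (n C m) * h (suc m) (n ∸ m)) n + (h 0 (suc n) + Σ≤ (λ m → (n C suc m) * h (suc m) (n ∸ m)) n)
          ≡ h 0 (suc n) + Σ≤ (λ m → (n C m + n C suc m) * h (suc m) (n ∸ m)) n
  regroup = begin
    S₁ + (h₀ + S₂)   ≡⟨ +-assoc S₁ h₀ S₂ ⟨
    (S₁ + h₀) + S₂   ≡⟨ cong (_+ S₂) (+-comm S₁ h₀) ⟩
    (h₀ + S₁) + S₂   ≡⟨ +-assoc h₀ S₁ S₂ ⟩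
    h₀ + (S₁ + S₂)   ≡⟨ cong (h₀ +_) (sym (trans (Σ≤-cong _ _ n (λ m _ → *-distribʳ-+ (h (suc m) (n ∸ m)) (n C m) (n C suc m)))
                                             (Σ≤-+ _ _ n))) ⟩
    h₀ + Σ≤ (λ m → (n C m + n C suc m) * h (suc m) (n ∸ m)) n ∎
    where
    h₀ S₁ S₂ : ℕ
    h₀ = h 0 (suc n)
    S₁  = Σ≤ (λ m → (n C m) * h (suc m) (n ∸ m)) n
    S₂  = Σ≤ (λ m → (n C suc m) * h (suc m) (n ∸ m)) n


onlyIfZero : ℕ → ℕ → ℕ
onlyIfZero zero    x = x
onlyIfZero (suc _) x = 0

Σ≤-onlyFirst : ∀ (g : ℕ → ℕ) n → Σ≤ (λ m → (n C m) * onlyIfZero m (g (n ∸ m))) n ≡ g n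
Σ≤-onlyFirst g zero    = *-identityˡ (g 0)
Σ≤-onlyFirst g (suc n) = begin
  Σ≤ (λ m → (suc n C m) * onlyIfZero m (g (suc n ∸ m))) (suc n)
    ≡⟨ Σ≤-first (λ m → (suc n C m) * onlyIfZero m (g (suc n ∸ m))) n ⟩
  1 * g (suc n) + Σ≤ (λ m → (suc n C suc m) * 0) n
    ≡⟨ cong₂ _+_ (*-identityˡ (g (suc n))) (Σ≤-zero _ n (λ m _ → *-zeroʳ (suc n C suc m))) ⟩
  g (suc n) + 0
    ≡⟨ +-identityʳ (g (suc n)) ⟩
  g (suc n) ∎
  where open ≡-Reasoning

Σ≤-onlyLast : ∀ (g : ℕ → ℕ) n → Σ≤ (λ m → (n C m) * onlyIfZero (n ∸ m) (g m)) n ≡ g n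
Σ≤-onlyLast g zero    = *-identityˡ (g 0)
Σ≤-onlyLast g (suc n) = begin
  Σ≤ (λ m → (suc n C m) * onlyIfZero (suc n ∸ m) (g m)) n + (suc n C suc n) * onlyIfZero (n ∸ n) (g (suc n))
    ≡⟨ cong₂ _+_ (Σ≤-zero _ n earlier-vanish)
                 (cong₂ (λ c d → c * onlyIfZero d (g (suc n))) (nCn≡1 (suc n)) (n∸n≡0 n)) ⟩
  0 + 1 * g (suc n)
    ≡⟨ *-identityˡ (g (suc n)) ⟩
  g (suc n) ∎
  where
  open ≡-Reasoning
  earlier-vanish : ∀ m → m ≤ n → (suc n C m) * onlyIfZero (suc n ∸ m) (g m) ≡ 0
  earlier-vanish m m≤n = trans (cong (λ d → (suc n C m) * onlyIfZero d (g m)) (suc-∸ n m m≤n))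
                               (*-zeroʳ (suc n C m))


-- the sequence a with its value at 0 replaced by 0 (the egfs have no constant term)
positive : (ℕ → ℕ) → ℕ → ℕ
positive a zero    = 0
positive a (suc n) = a (suc n)

module Recurrence (k : ℕ) (1≤k : 1 ≤ k) where
  open RunLengths k 1≤k

  A : ℕ → ℕ → ℕ → ℕ
  A i j n = count (adm i j) (arrangements n (ranks n))

  -- number of admissible words σ M τ with |σ| = a, |τ| = c, by the four cases
  -- σ, τ both empty / only σ empty / only τ empty / both nonempty
  Ψ : ℕ → ℕ → ℕ → ℕ → ℕ
  Ψ i j a c = onlyIfZero a (onlyIfZero c 1 + positive (A (i ∸ 1) j) c)
            + onlyIfZero c (positive (A i (j ∸ 1)) a)
            + positive (A i (k ∸ 1)) a * positive (A (k ∸ 1) j) c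

  aroundMax : ℕ → ℕ → List ℕ → List ℕ → ℕ → ℕ → ℕ
  aroundMax f M T₁ T₂ i j =
    sum (map (λ σ → count (λ τ → adm i j (σ ++ M ∷ τ)) (arrangements f T₂)) (arrangements f T₁))

  count-by-mask : ∀ f M S i j → count (adm i j) (arrangements (suc f) (M ∷ S)) ≡
                  sum (map (λ b → aroundMax f M (pick b S) (pick (complement b) S) i j) (masks (length S)))
  count-by-mask f M S i j = trans (count-concatMap (adm i j) (withMask f M S) (masks (length S)))
    (sum-cong _ _ (masks (length S)) (λ {b} _ →
      trans (count-concatMap (adm i j) (withPrefix f M S b) (arrangements f (pick b S)))
            (sum-cong _ _ (arrangements f (pick b S)) (λ {σ} _ →
              count-map (adm i j) (λ τ → σ ++ M ∷ τ) (arrangements f (pick (complement b) S))))))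

  SizeOnly : ℕ → Set
  SizeOnly f = ∀ S → Descending S → length S ≤ f → ∀ i j → i ≤ k → j ≤ k →
               count (adm i j) (arrangements f S) ≡ A i j (length S)

  below : ∀ f T M → Descending T → length T ≤ f → All (_< M) T → ∀ {σ} → σ ∈ arrangements f T → All (_< M) σ
  below f T M dT |T|≤f T<M σ∈ =
    All.tabulate (λ x∈σ → All.lookup T<M (sound (arrangements-sound f T dT |T|≤f σ∈) x∈σ))

  nonempty : ∀ f x T → Descending (x ∷ T) → length (x ∷ T) ≤ f → ∀ {σ} → σ ∈ arrangements f (x ∷ T) → σ ≢ []
  nonempty f x T d |T|≤f σ∈ refl with () ← full (arrangements-sound f (x ∷ T) d |T|≤f σ∈) (here refl)

  ∸1≤ : ∀ i → i ≤ k → i ∸ 1 ≤ k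
  ∸1≤ i i≤k = ≤-trans (m∸n≤m i 1) i≤k

  aroundMax≡Ψ : ∀ f → SizeOnly f → ∀ M T₁ T₂ → Descending T₁ → Descending T₂ → All (_< M) T₁ → All (_< M) T₂ →
                length T₁ ≤ f → length T₂ ≤ f → ∀ i j → 1 ≤ i → i ≤ k → 1 ≤ j → j ≤ k →
                aroundMax f M T₁ T₂ i j ≡ Ψ i j (length T₁) (length T₂)
  aroundMax≡Ψ f sizeOnly M [] [] _ _ _ _ _ _ i j 1≤i i≤k 1≤j j≤k rewrite adm-single i j M 1≤i 1≤j = refl
  aroundMax≡Ψ f sizeOnly M [] T₂@(_ ∷ _) _ d₂ _ T₂<M _ l₂ i j 1≤i i≤k 1≤j j≤k = begin
    count (λ τ → adm i j (M ∷ τ)) (arrangements f T₂) + 0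
      ≡⟨ +-identityʳ _ ⟩
    count (λ τ → adm i j (M ∷ τ)) (arrangements f T₂)
      ≡⟨ count-cong _ _ (arrangements f T₂) (λ τ∈ →
           adm-starting-at-max i j M _ 1≤i i≤k (below f T₂ M d₂ l₂ T₂<M τ∈) (nonempty f _ _ d₂ l₂ τ∈)) ⟩
    count (adm (i ∸ 1) j) (arrangements f T₂)
      ≡⟨ sizeOnly T₂ d₂ l₂ (i ∸ 1) j (∸1≤ i i≤k) j≤k ⟩
    A (i ∸ 1) j (length T₂)
      ≡⟨ trans (+-identityʳ _) (+-identityʳ _) ⟨
    Ψ i j 0 (length T₂) ∎
    where open ≡-Reasoning
  aroundMax≡Ψ f sizeOnly M T₁@(_ ∷ _) [] d₁ _ T₁<M _ l₁ _ i j 1≤i i≤k 1≤j j≤k = begin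
    sum (map (λ σ → count (λ τ → adm i j (σ ++ M ∷ τ)) [ [] ]) (arrangements f T₁))
      ≡⟨ sum-count-single (λ σ τ → adm i j (σ ++ M ∷ τ)) [] (arrangements f T₁) ⟩
    count (λ σ → adm i j (σ ++ [ M ])) (arrangements f T₁)
      ≡⟨ count-cong _ _ (arrangements f T₁) (λ σ∈ →
           adm-ending-at-max i j _ M 1≤j j≤k (below f T₁ M d₁ l₁ T₁<M σ∈) (nonempty f _ _ d₁ l₁ σ∈)) ⟩
    count (adm i (j ∸ 1)) (arrangements f T₁)
      ≡⟨ sizeOnly T₁ d₁ l₁ i (j ∸ 1) i≤k (∸1≤ j j≤k) ⟩
    A i (j ∸ 1) (length T₁)
      ≡⟨ trans (cong (A i (j ∸ 1) (length T₁) +_) (*-zeroʳ (A i (k ∸ 1) (length T₁)))) (+-identityʳ _) ⟨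
    Ψ i j (length T₁) 0 ∎
    where open ≡-Reasoning
  aroundMax≡Ψ f sizeOnly M T₁@(_ ∷ _) T₂@(_ ∷ _) d₁ d₂ T₁<M T₂<M l₁ l₂ i j 1≤i i≤k 1≤j j≤k = begin
    aroundMax f M T₁ T₂ i j
      ≡⟨ sum-cong _ _ (arrangements f T₁) (λ σ∈ → count-cong _ _ (arrangements f T₂) (λ τ∈ →
           adm-around-max i j _ M _ (below f T₁ M d₁ l₁ T₁<M σ∈) (below f T₂ M d₂ l₂ T₂<M τ∈)
                          (nonempty f _ _ d₁ l₁ σ∈) (nonempty f _ _ d₂ l₂ τ∈))) ⟩
    sum (map (λ σ → count (λ τ → adm i (k ∸ 1) σ ∧ adm (k ∸ 1) j τ) (arrangements f T₂)) (arrangements f T₁))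
      ≡⟨ count-pairs (adm i (k ∸ 1)) (adm (k ∸ 1) j) (arrangements f T₁) (arrangements f T₂) ⟩
    count (adm i (k ∸ 1)) (arrangements f T₁) * count (adm (k ∸ 1) j) (arrangements f T₂)
      ≡⟨ cong₂ _*_ (sizeOnly T₁ d₁ l₁ i (k ∸ 1) i≤k (∸1≤ k ≤-refl))
                   (sizeOnly T₂ d₂ l₂ (k ∸ 1) j (∸1≤ k ≤-refl) j≤k) ⟩
    Ψ i j (length T₁) (length T₂) ∎
    where open ≡-Reasoning

  count-by-sizes : ∀ f → SizeOnly f → ∀ M S → Descending (M ∷ S) → length S ≤ f →
                   ∀ i j → 1 ≤ i → i ≤ k → 1 ≤ j → j ≤ k →
                   count (adm i j) (arrangements (suc f) (M ∷ S)) ≡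
                   sum (map (λ b → Ψ i j (trues b) (trues (complement b))) (masks (length S)))
  count-by-sizes f sizeOnly M S (M>S ∷ dS) |S|≤f i j 1≤i i≤k 1≤j j≤k =
    trans (count-by-mask f M S i j) (sum-cong _ _ (masks (length S)) per-mask)
    where
    per-mask : ∀ {b} → b ∈ masks (length S) →
               aroundMax f M (pick b S) (pick (complement b) S) i j ≡ Ψ i j (trues b) (trues (complement b))
    per-mask {b} b∈ = trans
      (aroundMax≡Ψ f sizeOnly M (pick b S) (pick (complement b) S)
         (proj₁ (pick-invariant b S dS |S|≤f)) (proj₁ (pick-invariant (complement b) S dS |S|≤f))
         (pick-All b S M>S) (pick-All (complement b) S M>S)
         (proj₂ (pick-invariant b S dS |S|≤f)) (proj₂ (pick-invariant (complement b) S dS |S|≤f))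
         i j 1≤i i≤k 1≤j j≤k)
      (cong₂ (Ψ i j) (pick-length b S |b|) (pick-length (complement b) S (trans (length-map _ b) |b|)))
      where |b| = masks-length (length S) b∈

  count-nonempty-none : ∀ (p : List ℕ → Bool) → (∀ w → w ≢ [] → p w ≡ false) →
                        ∀ f x S → Descending (x ∷ S) → length (x ∷ S) ≤ f → count p (arrangements f (x ∷ S)) ≡ 0
  count-nonempty-none p none f x S d l = count-none p (arrangements f (x ∷ S)) (λ w∈ → none _ (nonempty f x S d l w∈))

  -- by induction on the fuel: both sides satisfy the same recursion on the size
  size-only : ∀ f → SizeOnly f
  size-only f       []      _ _ i j _ _ = refl
  size-only (suc f) (M ∷ S) d l zero j _ _ =
    trans (count-nonempty-none (adm 0 j) (adm-i=0 j) (suc f) M S d l)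
          (sym (count-nonempty-none (adm 0 j) (adm-i=0 j) _ _ _ (ranks-descending (suc (length S))) (ranks-length (suc (length S)))))
  size-only (suc f) (M ∷ S) d l (suc i) zero _ _ =
    trans (count-nonempty-none (adm (suc i) 0) (adm-j=0 (suc i)) (suc f) M S d l)
          (sym (count-nonempty-none (adm (suc i) 0) (adm-j=0 (suc i)) _ _ _ (ranks-descending (suc (length S))) (ranks-length (suc (length S)))))
  size-only (suc f) (M ∷ S) d (s≤s |S|≤f) (suc i) (suc j) i≤k j≤k = begin
    count (adm (suc i) (suc j)) (arrangements (suc f) (M ∷ S))
      ≡⟨ count-by-sizes f (size-only f) M S d |S|≤f (suc i) (suc j) (s≤s z≤n) i≤k (s≤s z≤n) j≤k ⟩
    sum (map Ψᵢⱼ (masks n))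
      ≡⟨ cong (λ m → sum (map Ψᵢⱼ (masks m))) (length-applyDownFrom suc n) ⟨
    sum (map Ψᵢⱼ (masks (length (ranks n))))
      ≡⟨ count-by-sizes f (size-only f) (suc n) (ranks n) (ranks-descending (suc n)) ranks≤f
                        (suc i) (suc j) (s≤s z≤n) i≤k (s≤s z≤n) j≤k ⟨
    count (adm (suc i) (suc j)) (arrangements (suc f) (ranks (suc n)))
      ≡⟨ cong (count (adm (suc i) (suc j))) (arrangements-fuel (suc f) (suc n) (ranks (suc n)) (s≤s ranks≤f) (ranks-length (suc n))) ⟩
    A (suc i) (suc j) (suc n) ∎
    where
    open ≡-Reasoning
    n : ℕ
    n = length S
    Ψᵢⱼ : List Bool → ℕ
    Ψᵢⱼ b = Ψ (suc i) (suc j) (trues b) (trues (complement b))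
    ranks≤f : length (ranks n) ≤ f
    ranks≤f = ≤-trans (ranks-length n) |S|≤f

  A-recurrence : ∀ i j n → 1 ≤ i → i ≤ k → 1 ≤ j → j ≤ k → A i j (suc n) ≡ Σ≤ (λ m → (n C m) * Ψ i j m (n ∸ m)) n
  A-recurrence i j n 1≤i i≤k 1≤j j≤k = begin
    A i j (suc n)
      ≡⟨ count-by-sizes n (size-only n) (suc n) (ranks n) (ranks-descending (suc n)) (ranks-length n) i j 1≤i i≤k 1≤j j≤k ⟩
    sum (map (λ b → Ψ i j (trues b) (trues (complement b))) (masks (length (ranks n))))
      ≡⟨ cong (λ m → sum (map (λ b → Ψ i j (trues b) (trues (complement b))) (masks m))) (length-applyDownFrom suc n) ⟩
    sum (map (λ b → Ψ i j (trues b) (trues (complement b))) (masks n))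
      ≡⟨ sum-masks n (Ψ i j) ⟩
    Σ≤ (λ m → (n C m) * Ψ i j m (n ∸ m)) n ∎
    where open ≡-Reasoning

  B≡A : ∀ i j n → B k i j (suc n) ≡ A i j (suc n)
  B≡A zero    j       n = sym (count-nonempty-none (adm 0 j) (adm-i=0 j) _ _ _ (ranks-descending (suc n)) (ranks-length (suc n)))
  B≡A (suc i) zero    n = sym (count-nonempty-none (adm (suc i) 0) (adm-j=0 (suc i)) _ _ _ (ranks-descending (suc n)) (ranks-length (suc n)))
  B≡A (suc i) (suc j) n = trans (count-filterᵇ (adm (suc i) (suc j)) (perms (suc n))) (count-perms (adm (suc i) (suc j)) (suc n))

  positive-B≡A : ∀ i j t → positive (B k i j) t ≡ positive (A i j) t
  positive-B≡A i j zero    = refl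
  positive-B≡A i j (suc n) = B≡A i j n

  B-recurrence : ∀ i j n → 1 ≤ i → i ≤ k → 1 ≤ j → j ≤ k →
    B k i j (suc n) ≡ (onlyIfZero n 1 + positive (B k (i ∸ 1) j) n) + positive (B k i (j ∸ 1)) n
                      + Σ≤ (λ m → (n C m) * (positive (B k i (k ∸ 1)) m * positive (B k (k ∸ 1) j) (n ∸ m))) n
  B-recurrence i j n 1≤i i≤k 1≤j j≤k = begin
    B k i j (suc n)
      ≡⟨ B≡A i j n ⟩
    A i j (suc n)
      ≡⟨ A-recurrence i j n 1≤i i≤k 1≤j j≤k ⟩
    Σ≤ (λ m → (n C m) * ((E₁ m + E₂ m) + P m)) n
      ≡⟨ Σ≤-cong _ _ n (λ m _ → trans (*-distribˡ-+ (n C m) (E₁ m + E₂ m) (P m))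
                                      (cong (_+ (n C m) * P m) (*-distribˡ-+ (n C m) (E₁ m) (E₂ m)))) ⟩
    Σ≤ (λ m → ((n C m) * E₁ m + (n C m) * E₂ m) + (n C m) * P m) n
      ≡⟨ trans (Σ≤-+ _ _ n) (cong (_+ Σ≤ (λ m → (n C m) * P m) n) (Σ≤-+ _ _ n)) ⟩
    (Σ≤ (λ m → (n C m) * E₁ m) n + Σ≤ (λ m → (n C m) * E₂ m) n) + Σ≤ (λ m → (n C m) * P m) n
      ≡⟨ cong₂ (λ a b → (a + b) + Σ≤ (λ m → (n C m) * P m) n)
               (Σ≤-onlyFirst (λ c → onlyIfZero c 1 + positive (A (i ∸ 1) j) c) n)
               (Σ≤-onlyLast (positive (A i (j ∸ 1))) n) ⟩
    (onlyIfZero n 1 + positive (A (i ∸ 1) j) n) + positive (A i (j ∸ 1)) n + Σ≤ (λ m → (n C m) * P m) n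
      ≡⟨ cong₂ _+_ (cong₂ (λ a b → (onlyIfZero n 1 + a) + b) (sym (positive-B≡A (i ∸ 1) j n))
                                                            (sym (positive-B≡A i (j ∸ 1) n)))
                   (Σ≤-cong _ _ n (λ m _ → cong ((n C m) *_)
                      (sym (cong₂ _*_ (positive-B≡A i (k ∸ 1) m) (positive-B≡A (k ∸ 1) j (n ∸ m)))))) ⟩
    (onlyIfZero n 1 + positive (B k (i ∸ 1) j) n) + positive (B k i (j ∸ 1)) n
      + Σ≤ (λ m → (n C m) * (positive (B k i (k ∸ 1)) m * positive (B k (k ∸ 1) j) (n ∸ m))) n ∎
    where
    open ≡-Reasoning
    E₁ E₂ P : ℕ → ℕ
    E₁ m = onlyIfZero m (onlyIfZero (n ∸ m) 1 + positive (A (i ∸ 1) j) (n ∸ m))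
    E₂ m = onlyIfZero (n ∸ m) (positive (A i (j ∸ 1)) m)
    P  m = positive (A i (k ∸ 1)) m * positive (A (k ∸ 1) j) (n ∸ m)


/-cong : ∀ a b c d .{{_ : NonZero c}} .{{_ : NonZero d}} → a * d ≡ b * c → ℤ.+ a / c ≡ ℤ.+ b / d
/-cong a b (suc c) (suc d) ad≡bc = ℚₚ.fromℚᵘ-cong {mkℚᵘ (ℤ.+ a) c} {mkℚᵘ (ℤ.+ b) d}
  (*≡* (trans (sym (pos-* a (suc d))) (trans (cong ℤ.+_ ad≡bc) (pos-* b (suc c)))))

toℚᵘ-/ : ∀ a c → toℚᵘ (ℤ.+ a / suc c) ≃ᵘ mkℚᵘ (ℤ.+ a) c
toℚᵘ-/ a c = ℚₚ.toℚᵘ-fromℚᵘ (mkℚᵘ (ℤ.+ a) c)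

/-+ : ∀ a b c d .{{_ : NonZero c}} .{{_ : NonZero d}} →
      (ℤ.+ a / c) ℚ.+ (ℤ.+ b / d) ≡ (ℤ.+ (a * d + b * c) / (c * d)) {{m*n≢0 c d}}
/-+ a b (suc c) (suc d) = ℚₚ.toℚᵘ-injective
  (ℚᵘₚ.≃-trans (ℚₚ.toℚᵘ-homo-+ (ℤ.+ a / suc c) (ℤ.+ b / suc d))
  (ℚᵘₚ.≃-trans (ℚᵘₚ.+-cong (toℚᵘ-/ a c) (toℚᵘ-/ b d))
  (ℚᵘₚ.≃-trans (ℚᵘₚ.≃-reflexive (cong (λ z → mkℚᵘ z (d + c * suc d)) numerator))
  (ℚᵘₚ.≃-sym (toℚᵘ-/ (a * suc d + b * suc c) (d + c * suc d))))))
  where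
  numerator : ℤ.+ a ℤ.* ℤ.+ suc d ℤ.+ ℤ.+ b ℤ.* ℤ.+ suc c ≡ ℤ.+ (a * suc d + b * suc c)
  numerator = trans (cong₂ ℤ._+_ (sym (pos-* a (suc d))) (sym (pos-* b (suc c)))) (sym (pos-+ (a * suc d) (b * suc c)))

/-* : ∀ a b c d .{{_ : NonZero c}} .{{_ : NonZero d}} →
      (ℤ.+ a / c) ℚ.* (ℤ.+ b / d) ≡ (ℤ.+ (a * b) / (c * d)) {{m*n≢0 c d}}
/-* a b (suc c) (suc d) = ℚₚ.toℚᵘ-injective
  (ℚᵘₚ.≃-trans (ℚₚ.toℚᵘ-homo-* (ℤ.+ a / suc c) (ℤ.+ b / suc d))
  (ℚᵘₚ.≃-trans (ℚᵘₚ.*-cong (toℚᵘ-/ a c) (toℚᵘ-/ b d))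
  (ℚᵘₚ.≃-trans (ℚᵘₚ.≃-reflexive (cong (λ z → mkℚᵘ z (d + c * suc d)) (sym (pos-* a b))))
  (ℚᵘₚ.≃-sym (toℚᵘ-/ (a * b) (d + c * suc d))))))

/-+-same : ∀ a b d .{{_ : NonZero d}} → (ℤ.+ a / d) ℚ.+ (ℤ.+ b / d) ≡ ℤ.+ (a + b) / d
/-+-same a b d = trans (/-+ a b d d) (/-cong (a * d + b * d) (a + b) (d * d) d {{m*n≢0 d d}}
  (solve 3 (λ a b d → (a :* d :+ b :* d) :* d := (a :+ b) :* (d :* d)) refl a b d))


coeff : ℕ → ℕ → ℚ
coeff a n = (ℤ.+ a / n !) {{n !≢0}}

coeff-+ : ∀ a b n → coeff a n ℚ.+ coeff b n ≡ coeff (a + b) n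
coeff-+ a b n = /-+-same a b (n !) {{n !≢0}}

binomial-factorials : ∀ n t → t ≤ n → (n C t) * (t ! * (n ∸ t) !) ≡ n !
binomial-factorials n t t≤n =
  trans (cong (_* (t ! * (n ∸ t) !)) (nCk≡n!/k![n-k]! t≤n)) (m/n*n≡m {{m*n≢0 (t !) ((n ∸ t) !) {{t !≢0}} {{(n ∸ t) !≢0}}}} (k![n∸k]!∣n! t≤n))

egf-coeff : ∀ a n → egf a n ≡ coeff (positive a n) n
egf-coeff a zero    = sym (ℚₚ.0/n≡0 1)
egf-coeff a (suc n) = refl

oneₚ-coeff : ∀ n → oneₚ n ≡ coeff (onlyIfZero n 1) n
oneₚ-coeff zero    = refl
oneₚ-coeff (suc n) = sym (ℚₚ.0/n≡0 (suc n !) {{suc n !≢0}})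

deriv-egf-coeff : ∀ a n → deriv (egf a) n ≡ coeff (a (suc n)) n
deriv-egf-coeff a n = trans (/-* (suc n) (a (suc n)) 1 (suc n !) {{_}} {{suc n !≢0}})
  (/-cong (suc n * a (suc n)) (a (suc n)) (1 * suc n !) (n !) {{m*n≢0 1 (suc n !) {{_}} {{suc n !≢0}}}} {{n !≢0}} cross)
  where
  cross : suc n * a (suc n) * n ! ≡ a (suc n) * (1 * suc n !)
  cross = trans (solve 3 (λ s b F → (s :* b) :* F := b :* (s :* F)) refl (suc n) (a (suc n)) (n !))
                (cong (a (suc n) *_) (sym (*-identityˡ (suc n !))))

egf-product-coeff : ∀ X Y n t → t ≤ n →
                    egf X t ℚ.* egf Y (n ∸ t) ≡ coeff ((n C t) * (positive X t * positive Y (n ∸ t))) n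
egf-product-coeff X Y n t t≤n = begin
  egf X t ℚ.* egf Y (n ∸ t)
    ≡⟨ cong₂ ℚ._*_ (egf-coeff X t) (egf-coeff Y (n ∸ t)) ⟩
  coeff x t ℚ.* coeff y (n ∸ t)
    ≡⟨ /-* x y (t !) ((n ∸ t) !) {{t !≢0}} {{(n ∸ t) !≢0}} ⟩
  (ℤ.+ (x * y) / (t ! * (n ∸ t) !)) {{t![n-t]!≢0}}
    ≡⟨ /-cong (x * y) ((n C t) * (x * y)) (t ! * (n ∸ t) !) (n !) {{t![n-t]!≢0}} {{n !≢0}} cross ⟩
  coeff ((n C t) * (x * y)) n ∎
  where
  open ≡-Reasoning
  x y : ℕ
  x = positive X t
  y = positive Y (n ∸ t)
  t![n-t]!≢0 : NonZero (t ! * (n ∸ t) !)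
  t![n-t]!≢0 = m*n≢0 (t !) ((n ∸ t) !) {{t !≢0}} {{(n ∸ t) !≢0}}
  cross : x * y * n ! ≡ (n C t) * (x * y) * (t ! * (n ∸ t) !)
  cross = trans (cong (x * y *_) (sym (binomial-factorials n t t≤n)))
    (solve 3 (λ p b D → p :* (b :* D) := (b :* p) :* D) refl (x * y) (n C t) (t ! * (n ∸ t) !))

convSum-egf : ∀ X Y n m → m ≤ n → convSum (egf X) (egf Y) n m ≡
              coeff (Σ≤ (λ t → (n C t) * (positive X t * positive Y (n ∸ t))) m) n
convSum-egf X Y n zero    _   = egf-product-coeff X Y n 0 z≤n
convSum-egf X Y n (suc m) m<n =
  trans (cong₂ ℚ._+_ (convSum-egf X Y n m (<⇒≤ m<n)) (egf-product-coeff X Y n (suc m) m<n))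
        (coeff-+ (Σ≤ (λ t → (n C t) * (positive X t * positive Y (n ∸ t))) m)
                 ((n C suc m) * (positive X (suc m) * positive Y (n ∸ suc m))) n)

mainTheorem5 : (k : ℕ) → 1 ≤ k → (i j : ℕ) → 1 ≤ i → i ≤ k → 1 ≤ j → j ≤ k →
    deriv (𝓑 k i j)
      ≈ₚ (((oneₚ +ₚ 𝓑 k (i ∸ 1) j) +ₚ 𝓑 k i (j ∸ 1)) +ₚ (𝓑 k i (k ∸ 1) *ₚ 𝓑 k (k ∸ 1) j))
mainTheorem5 k 1≤k i j 1≤i i≤k 1≤j j≤k n = begin
  deriv (𝓑 k i j) n
    ≡⟨ deriv-egf-coeff (B k i j) n ⟩
  coeff (B k i j (suc n)) n
    ≡⟨ cong (λ a → coeff a n) (B-recurrence i j n 1≤i i≤k 1≤j j≤k) ⟩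
  coeff ((δ + b₁) + b₂ + conv) n
    ≡⟨ coeff-+ (δ + b₁ + b₂) conv n ⟨
  coeff ((δ + b₁) + b₂) n ℚ.+ coeff conv n
    ≡⟨ cong (ℚ._+ coeff conv n) (trans (cong (ℚ._+ coeff b₂ n) (coeff-+ δ b₁ n)) (coeff-+ (δ + b₁) b₂ n)) ⟨
  (coeff δ n ℚ.+ coeff b₁ n ℚ.+ coeff b₂ n) ℚ.+ coeff conv n
    ≡⟨ cong₂ ℚ._+_ (cong₂ ℚ._+_ (cong₂ ℚ._+_ (oneₚ-coeff n) (egf-coeff (B k (i ∸ 1) j) n)) (egf-coeff (B k i (j ∸ 1)) n))
                   (convSum-egf (B k i (k ∸ 1)) (B k (k ∸ 1) j) n n ≤-refl) ⟨
  (((oneₚ +ₚ 𝓑 k (i ∸ 1) j) +ₚ 𝓑 k i (j ∸ 1)) +ₚ (𝓑 k i (k ∸ 1) *ₚ 𝓑 k (k ∸ 1) j)) n ∎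
  where
  open ≡-Reasoning
  open Recurrence k 1≤k using (B-recurrence)
  δ b₁ b₂ conv : ℕ
  δ    = onlyIfZero n 1
  b₁   = positive (B k (i ∸ 1) j) n
  b₂   = positive (B k i (j ∸ 1)) n
  conv = Σ≤ (λ m → (n C m) * (positive (B k i (k ∸ 1)) m * positive (B k (k ∸ 1) j) (n ∸ m))) n
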